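{- Let $m\geqslant 2$ and $k\geqslant 2$. Suppose $u,u',\gamma,\gamma',\delta,\delta'\in\mathcal{A}_m^*$ satisfy $\gamma\delta\sim_1\gamma'\delta'$ and $|u|=|u'|$. Then \[\binom{\sigma_m^{k-1}(\gamma\sigma_m(u)\delta)}{0\,\overline{1}\cdots\overline{k}}-\binom{\sigma_m^{k-1}(\gamma'\sigma_m(u')\delta')}{0\,\overline{1}\cdots\overline{k}}\] equals \[m^{\binom{k}{2}}\Big[|u|_0-|u'|_0+|u|\big(|\gamma|_0-|\gamma'|_0+|\delta|_{\overline{1}}-|\delta'|_{\overline{1}}\big)\Big]+m^{\binom{k}{2}-1}\sum_{b\in\mathcal{A}_m}\left(\binom{\gamma\delta}{b\,\overline{1}}-\binom{\gamma'\delta'}{b\,\overline{1}}+\binom{\gamma\delta}{0\,b}-\binom{\gamma'\delta'}{0\,b}\right).\]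
   Context: $\mathcal{A}_m=\{0,\ldots,m-1\}=\mathbb{Z}/m\mathbb{Z}$; letters are reduced mod $m$ and $\overline{a}$ denotes the letter $-a\bmod m$ (so $\overline{1}=m-1$). $\sigma_m$ is the morphism $\sigma_m(i)=i\,(i+1)\cdots(i+m-1)$. $|w|_a$ is the number of occurrences of the letter $a$ in $w$. $\binom{u}{w}$ is the number of occurrences of $w$ as a (not necessarily contiguous) subword of $u$; $\sim_1$ denotes abelian equivalence (same number of occurrences of each letter). -}

module Defs where

open import Data.Nat using (ℕ; zero; suc; _+_; _*_; _∸_; NonZero)
open import Data.Nat.DivMod using (_mod_)
open import Data.Fin using (Fin; toℕ)
open import Data.Fin.Properties using (_≟_)
open import Data.List using (List; []; _∷_; map; concatMap; upTo; _++_; length)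
open import Relation.Nullary using (yes; no)
open import Relation.Binary.PropositionalEquality using (_≡_)

-- Alphabet A_m = Z/mZ, represented as Fin m; words are lists.
Letter : ℕ → Set
Letter m = Fin m

Word : ℕ → Set
Word m = List (Fin m)

letter : (m : ℕ) .{{_ : NonZero m}} → ℕ → Letter m
letter m i = i mod m

-- overline a = -a mod m
neg : (m : ℕ) .{{_ : NonZero m}} → Letter m → Letter m
neg m a = letter m (m ∸ toℕ a)

σ-letter : (m : ℕ) .{{_ : NonZero m}} → Letter m → Word m
σ-letter m i = map (λ j → letter m (toℕ i + j)) (upTo m)

σ : (m : ℕ) .{{_ : NonZero m}} → Word m → Word m
σ m w = concatMap (σ-letter m) w

σ^ : (m : ℕ) .{{_ : NonZero m}} → ℕ → Word m → Word m
σ^ m zero    w = w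
σ^ m (suc n) w = σ m (σ^ m n w)

count : {m : ℕ} → Letter m → Word m → ℕ
count a []      = 0
count a (b ∷ w) with a ≟ b
... | yes _ = suc (count a w)
... | no  _ = count a w

binom : {m : ℕ} → Word m → Word m → ℕ
binom u       []      = 1
binom []      (_ ∷ _) = 0
binom (a ∷ u) (b ∷ w) with a ≟ b
... | yes _ = binom u w + binom u (b ∷ w)
... | no  _ = binom u (b ∷ w)

_∼₁_ : {m : ℕ} → Word m → Word m → Set
_∼₁_ {m} u v = ∀ (a : Letter m) → count a u ≡ count a v

pattern-word : (m : ℕ) .{{_ : NonZero m}} → ℕ → Word m
pattern-word m k = map (λ i → neg m (letter m i)) (upTo (suc k))

{-# OPTIONS --safe #-}
-- Put K = k − 1.  Since σ_m(a) is a cyclic shift of 0 1 ⋯ (m−1), the blocks σ_m^K(a) are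
-- pairwise K-binomially equivalent (induction on K).  Split an occurrence of x = 0 1̄ ⋯ k̄
-- (length K + 2) in σ_m^K(w) = σ_m^K(w₁) ⋯ σ_m^K(wₙ) according to the blocks it meets: pieces
-- of length ≤ K contribute an amount depending only on n, so for w ∼₁ w′ only occurrences inside
-- one block (which cancel by abelian equivalence) and occurrences split over two blocks as
-- (first K + 1 letters | last letter) or (first letter | last K + 1 letters) survive.  Every
-- block contains each letter m^(K−1) times and σ_m commutes with a ↦ a + 1, so these are
-- governed by t(a) = binom(σ_m^K(a), 0 1̄ ⋯ K̄) = c + m^C(K,2) [a = 0], and the difference becomes
-- m^(C(k,2)−1) (Q(w) − Q(w′)) with Q(w) = #{i < j : wᵢ = 0} + #{i < j : wⱼ = 1̄}.  The same
-- computation one level down, with Q(σ_m(a)) = c′ + m [a = 0] (rotate σ_m(a) one letter at a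
-- time), proves the formula for t by induction; evaluating Q on γ σ_m(u) δ gives the theorem.
module Submission where

open import Defs
open import Data.Nat using (ℕ; _≤_; _∸_; NonZero)
open import Data.Nat.Combinatorics using (_C_)
open import Data.Nat.Combinatorics using (nC1≡n; nCk+nC[k+1]≡[n+1]C[k+1])
open import Data.Fin using (Fin)
open import Data.List using (List; _∷_; []; _++_; length; map; allFin; foldr)
open import Data.Integer using (ℤ; +_; _+_; _-_; _*_; _^_)
open import Relation.Binary.PropositionalEquality using (_≡_)

open import Data.Nat using (zero; suc; _<_; s≤s; z≤n)
import Data.Nat as ℕ
import Data.Nat.Properties as ℕₚ
open import Algebra.Properties.CommutativeSemigroup ℕₚ.+-commutativeSemigroup using (x∙yz≈y∙xz)
open import Data.Fin using (toℕ)
open import Data.Nat.DivMod using (_%_)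
import Data.Nat.DivMod as ℕ%
import Data.Fin as Fin
import Data.Fin.Properties as Finₚ
open import Data.List using ([_]; take; drop; concatMap; upTo; applyUpTo; tabulate)
import Data.List.Properties as Listₚ
import Data.Integer.Properties as ℤₚ
open import Data.Integer.Tactic.RingSolver using (solve-∀)
open import Relation.Binary.PropositionalEquality using (_≢_; refl; sym; trans; cong; cong₂; module ≡-Reasoning)
open import Relation.Nullary using (yes; no)
open import Data.Empty using (⊥-elim)
open import Data.Sum using (inj₁; inj₂)
open import Function using (id; _∘_)
open import Function.Definitions using (Injective)

sumMap : {A : Set} → (A → ℤ) → List A → ℤ
sumMap f xs = foldr _+_ (+ 0) (map f xs)

module _ {A : Set} where

  sumMap-++ : ∀ (f : A → ℤ) xs ys → sumMap f (xs ++ ys) ≡ sumMap f xs + sumMap f ys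
  sumMap-++ f []       ys = sym (ℤₚ.+-identityˡ _)
  sumMap-++ f (x ∷ xs) ys = trans (cong (_+_ (f x)) (sumMap-++ f xs ys)) (sym (ℤₚ.+-assoc (f x) _ _))

  sumMap-cong : ∀ {f g : A → ℤ} → (∀ a → f a ≡ g a) → ∀ xs → sumMap f xs ≡ sumMap g xs
  sumMap-cong f≗g []       = refl
  sumMap-cong f≗g (x ∷ xs) = cong₂ _+_ (f≗g x) (sumMap-cong f≗g xs)

  sumMap-+ : ∀ (f g : A → ℤ) xs → sumMap (λ a → f a + g a) xs ≡ sumMap f xs + sumMap g xs
  sumMap-+ f g []       = refl
  sumMap-+ f g (x ∷ xs) = trans (cong (_+_ (f x + g x)) (sumMap-+ f g xs)) (ring (f x) (g x) _ _)
    where ring : ∀ a b c d → a + b + (c + d) ≡ a + c + (b + d)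
          ring = solve-∀

  sumMap-- : ∀ (f g : A → ℤ) xs → sumMap (λ a → f a - g a) xs ≡ sumMap f xs - sumMap g xs
  sumMap-- f g []       = refl
  sumMap-- f g (x ∷ xs) = trans (cong (_+_ (f x - g x)) (sumMap-- f g xs)) (ring (f x) (g x) _ _)
    where ring : ∀ a b c d → a - b + (c - d) ≡ a + c - (b + d)
          ring = solve-∀

  sumMap-*ˡ : ∀ c (f : A → ℤ) xs → sumMap (λ a → c * f a) xs ≡ c * sumMap f xs
  sumMap-*ˡ c f []       = sym (ℤₚ.*-zeroʳ c)
  sumMap-*ˡ c f (x ∷ xs) = trans (cong (_+_ (c * f x)) (sumMap-*ˡ c f xs)) (sym (ℤₚ.*-distribˡ-+ c (f x) _))

  sumMap-const : ∀ c (xs : List A) → sumMap (λ _ → c) xs ≡ c * + length xs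
  sumMap-const c []       = sym (ℤₚ.*-zeroʳ c)
  sumMap-const c (x ∷ xs) = trans (cong (_+_ c) (sumMap-const c xs)) (ring c (+ length xs))
    where ring : ∀ c l → c + c * l ≡ c * (+ 1 + l)
          ring = solve-∀

sumTo : (ℕ → ℤ) → ℕ → ℤ
sumTo F zero    = + 0
sumTo F (suc n) = F 0 + sumTo (F ∘ suc) n

sumTo-cong : ∀ {F G : ℕ → ℤ} n → (∀ i → i < n → F i ≡ G i) → sumTo F n ≡ sumTo G n
sumTo-cong zero    F≗G = refl
sumTo-cong (suc n) F≗G = cong₂ _+_ (F≗G 0 (s≤s z≤n)) (sumTo-cong n (λ i i<n → F≗G (suc i) (s≤s i<n)))

sumTo-zero : ∀ {F : ℕ → ℤ} n → (∀ i → i < n → F i ≡ + 0) → sumTo F n ≡ + 0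
sumTo-zero zero    F≗0 = refl
sumTo-zero (suc n) F≗0 = cong₂ _+_ (F≗0 0 (s≤s z≤n)) (sumTo-zero n (λ i i<n → F≗0 (suc i) (s≤s i<n)))

sumTo-split : ∀ (F : ℕ → ℤ) a b → sumTo F (a ℕ.+ b) ≡ sumTo F a + sumTo (λ t → F (a ℕ.+ t)) b
sumTo-split F zero    b = sym (ℤₚ.+-identityˡ _)
sumTo-split F (suc a) b = trans (cong (_+_ (F 0)) (sumTo-split (F ∘ suc) a b)) (sym (ℤₚ.+-assoc (F 0) _ _))

sumTo-- : ∀ (F G : ℕ → ℤ) n → sumTo (λ i → F i - G i) n ≡ sumTo F n - sumTo G n
sumTo-- F G zero    = refl
sumTo-- F G (suc n) = trans (cong (_+_ (F 0 - G 0)) (sumTo-- (F ∘ suc) (G ∘ suc) n)) (ring (F 0) (G 0) _ _)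
  where ring : ∀ a b c d → a - b + (c - d) ≡ a + c - (b + d)
        ring = solve-∀

sumTo-linear : ∀ c (F G : ℕ → ℤ) n → sumTo (λ i → c * F i + G i) n ≡ c * sumTo F n + sumTo G n
sumTo-linear c F G zero    = sym (trans (ℤₚ.+-identityʳ _) (ℤₚ.*-zeroʳ c))
sumTo-linear c F G (suc n) =
  trans (cong (_+_ (c * F 0 + G 0)) (sumTo-linear c (F ∘ suc) (G ∘ suc) n)) (ring c (F 0) (G 0) _ _)
  where ring : ∀ c f g s t → c * f + g + (c * s + t) ≡ c * (f + s) + (g + t)
        ring = solve-∀

𝟙 : {m : ℕ} → Letter m → Letter m → ℤ
𝟙 e a = + count e [ a ]

module _ {m : ℕ} where

  𝟙-≡ : ∀ {e a : Letter m} → e ≡ a → 𝟙 e a ≡ + 1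
  𝟙-≡ {e} {a} e≡a with e Finₚ.≟ a
  ... | yes _   = refl
  ... | no  e≢a = ⊥-elim (e≢a e≡a)

  𝟙-≢ : ∀ {e a : Letter m} → e ≢ a → 𝟙 e a ≡ + 0
  𝟙-≢ {e} {a} e≢a with e Finₚ.≟ a
  ... | yes e≡a = ⊥-elim (e≢a e≡a)
  ... | no  _   = refl

  𝟙-sym : ∀ (e a : Letter m) → 𝟙 e a ≡ 𝟙 a e
  𝟙-sym e a with e Finₚ.≟ a
  ... | yes e≡a = sym (𝟙-≡ (sym e≡a))
  ... | no  e≢a = sym (𝟙-≢ (e≢a ∘ sym))

  count-∷ : ∀ (e a : Letter m) v → + count e (a ∷ v) ≡ 𝟙 e a + + count e v
  count-∷ e a v with e Finₚ.≟ a
  ... | yes _ = refl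
  ... | no  _ = refl

  count-++ : ∀ (e : Letter m) u v → count e (u ++ v) ≡ count e u ℕ.+ count e v
  count-++ e []      v = refl
  count-++ e (a ∷ u) v with e Finₚ.≟ a
  ... | yes _ = cong suc (count-++ e u v)
  ... | no  _ = count-++ e u v

  sumMap-𝟙 : ∀ (e : Letter m) v → sumMap (𝟙 e) v ≡ + count e v
  sumMap-𝟙 e []      = refl
  sumMap-𝟙 e (a ∷ v) = trans (cong (_+_ (𝟙 e a)) (sumMap-𝟙 e v)) (sym (count-∷ e a v))

  binom-∷ : ∀ (a b : Letter m) u w → + binom (a ∷ u) (b ∷ w) ≡ 𝟙 b a * + binom u w + + binom u (b ∷ w)
  binom-∷ a b u w with a Finₚ.≟ b | b Finₚ.≟ a
  ... | yes _   | yes _   = cong (_+ + binom u (b ∷ w)) (sym (ℤₚ.*-identityˡ (+ binom u w)))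
  ... | no  _   | no  _   = refl
  ... | yes a≡b | no  b≢a = ⊥-elim (b≢a (sym a≡b))
  ... | no  a≢b | yes b≡a = ⊥-elim (a≢b (sym b≡a))

  binom-letter : ∀ (e : Letter m) u → binom u [ e ] ≡ count e u
  binom-letter e []      = refl
  binom-letter e (a ∷ u) = ℤₚ.+-injective (begin
    + binom (a ∷ u) [ e ]              ≡⟨ binom-∷ a e u [] ⟩
    𝟙 e a * + 1 + + binom u [ e ]      ≡⟨ cong₂ _+_ (ℤₚ.*-identityʳ (𝟙 e a)) (cong +_ (binom-letter e u)) ⟩
    𝟙 e a + + count e u                ≡⟨ count-∷ e a u ⟨
    + count e (a ∷ u)                  ∎)
    where open ≡-Reasoning

𝟙-injective : ∀ {m m′} {f : Letter m → Letter m′} → Injective _≡_ _≡_ f → ∀ e a → 𝟙 (f e) (f a) ≡ 𝟙 e a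
𝟙-injective {f = f} f-inj e a with e Finₚ.≟ a
... | yes e≡a = 𝟙-≡ (cong f e≡a)
... | no  e≢a = 𝟙-≢ (e≢a ∘ f-inj)

sumMap-allFin-suc : ∀ {k} (g : Fin (suc k) → ℤ) → sumMap g (allFin (suc k)) ≡ g Fin.zero + sumMap (g ∘ Fin.suc) (allFin k)
sumMap-allFin-suc g = cong (λ xs → g Fin.zero + foldr _+_ (+ 0) xs)
  (trans (Listₚ.map-tabulate Fin.suc g) (sym (Listₚ.map-tabulate id (g ∘ Fin.suc))))

sumMap-allFin-𝟙 : ∀ {k} (a : Fin k) (f : Fin k → ℤ) → sumMap (λ b → 𝟙 b a * f b) (allFin k) ≡ f a
sumMap-allFin-𝟙 {suc k} a f = trans (sumMap-allFin-suc (λ b → 𝟙 b a * f b)) (split a)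
  where
  split : ∀ a → 𝟙 Fin.zero a * f Fin.zero + sumMap (λ b → 𝟙 (Fin.suc b) a * f (Fin.suc b)) (allFin k) ≡ f a
  split Fin.zero    = trans (cong (_+_ (+ 1 * f Fin.zero)) (sumMap-const (+ 0) (allFin k)))
                            (trans (ℤₚ.+-identityʳ _) (ℤₚ.*-identityˡ _))
  split (Fin.suc a) = trans (ℤₚ.+-identityˡ _)
    (trans (sumMap-cong (λ b → cong (_* f (Fin.suc b)) (𝟙-injective {f = Fin.suc} Finₚ.suc-injective b a)) (allFin k))
           (sumMap-allFin-𝟙 a (f ∘ Fin.suc)))

count-allFin : ∀ {k} (e : Fin k) → count e (allFin k) ≡ 1
count-allFin {k} e = ℤₚ.+-injective (begin
  + count e (allFin k)                          ≡⟨ sumMap-𝟙 e (allFin k) ⟨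
  sumMap (𝟙 e) (allFin k)                       ≡⟨ sumMap-cong (λ b → trans (𝟙-sym e b) (sym (ℤₚ.*-identityʳ _))) (allFin k) ⟩
  sumMap (λ b → 𝟙 b e * + 1) (allFin k)         ≡⟨ sumMap-allFin-𝟙 e (λ _ → + 1) ⟩
  + 1                                           ∎)
  where open ≡-Reasoning

sumMap-𝟙-allFin : ∀ {k} (e : Fin k) → sumMap (𝟙 e) (allFin k) ≡ + 1
sumMap-𝟙-allFin e = trans (sumMap-𝟙 e (allFin _)) (cong +_ (count-allFin e))

module _ {A : Set} where

  length-take-≤ˡ : ∀ i (x : List A) → length (take i x) ≤ i
  length-take-≤ˡ i x = ℕₚ.≤-trans (ℕₚ.≤-reflexive (Listₚ.length-take i x)) (ℕₚ.m⊓n≤m i (length x))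

  length-take-≤ʳ : ∀ i (x : List A) → length (take i x) ≤ length x
  length-take-≤ʳ i x = ℕₚ.≤-trans (ℕₚ.≤-reflexive (Listₚ.length-take i x)) (ℕₚ.m⊓n≤n i (length x))

  length-drop-≤ : ∀ i (x : List A) → length (drop i x) ≤ length x
  length-drop-≤ i x = ℕₚ.≤-trans (ℕₚ.≤-reflexive (Listₚ.length-drop i x)) (ℕₚ.m∸n≤m (length x) i)

applyUpTo-tabulate : ∀ {A : Set} (f : ℕ → A) k → applyUpTo f k ≡ tabulate {n = k} (f ∘ toℕ)
applyUpTo-tabulate f zero    = refl
applyUpTo-tabulate f (suc k) = cong (f 0 ∷_) (applyUpTo-tabulate (f ∘ suc) k)

take-applyUpTo : ∀ {A : Set} (f : ℕ → A) k → take k (applyUpTo f (suc k)) ≡ applyUpTo f k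
take-applyUpTo f zero    = refl
take-applyUpTo f (suc k) = cong (f 0 ∷_) (take-applyUpTo (f ∘ suc) k)

binom-map-injective : ∀ {m m′} {f : Letter m → Letter m′} → Injective _≡_ _≡_ f →
                      ∀ u x → binom (map f u) (map f x) ≡ binom u x
binom-map-injective f-inj u       []      = refl
binom-map-injective f-inj []      (b ∷ x) = refl
binom-map-injective {f = f} f-inj (a ∷ u) (b ∷ x) = ℤₚ.+-injective (begin
  + binom (f a ∷ map f u) (f b ∷ map f x)
    ≡⟨ binom-∷ (f a) (f b) (map f u) (map f x) ⟩
  𝟙 (f b) (f a) * + binom (map f u) (map f x) + + binom (map f u) (f b ∷ map f x)
    ≡⟨ cong₂ (λ i p → i * + p + + binom (map f u) (f b ∷ map f x)) (𝟙-injective f-inj b a) (binom-map-injective f-inj u x) ⟩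
  𝟙 b a * + binom u x + + binom (map f u) (map f (b ∷ x))
    ≡⟨ cong (λ p → 𝟙 b a * + binom u x + + p) (binom-map-injective f-inj u (b ∷ x)) ⟩
  𝟙 b a * + binom u x + + binom u (b ∷ x)
    ≡⟨ binom-∷ a b u x ⟨
  + binom (a ∷ u) (b ∷ x) ∎)
  where open ≡-Reasoning

module _ {m : ℕ} where

  sumMap-count : ∀ (f : Letter m → ℤ) v → sumMap f v ≡ sumMap (λ e → + count e v * f e) (allFin m)
  sumMap-count f []      = sym (sumMap-const (+ 0) (allFin m))
  sumMap-count f (c ∷ v) = begin
    f c + sumMap f v
      ≡⟨ cong₂ _+_ (sumMap-allFin-𝟙 c f) (sym (sumMap-count f v)) ⟨
    sumMap (λ e → 𝟙 e c * f e) (allFin m) + sumMap (λ e → + count e v * f e) (allFin m)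
      ≡⟨ sumMap-+ (λ e → 𝟙 e c * f e) (λ e → + count e v * f e) (allFin m) ⟨
    sumMap (λ e → 𝟙 e c * f e + + count e v * f e) (allFin m)
      ≡⟨ sumMap-cong (λ e → trans (cong (_* f e) (count-∷ e c v)) (ℤₚ.*-distribʳ-+ (f e) (𝟙 e c) (+ count e v))) (allFin m) ⟨
    sumMap (λ e → + count e (c ∷ v) * f e) (allFin m) ∎
    where open ≡-Reasoning

  sumMap-∼₁ : ∀ (f : Letter m → ℤ) {u v} → u ∼₁ v → sumMap f u ≡ sumMap f v
  sumMap-∼₁ f {u} {v} u∼v = trans (sumMap-count f u)
    (trans (sumMap-cong (λ e → cong (λ k → + k * f e) (u∼v e)) (allFin m)) (sym (sumMap-count f v)))

  length-∼₁ : ∀ {u v : Word m} → u ∼₁ v → length u ≡ length v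
  length-∼₁ {u} {v} u∼v = ℤₚ.+-injective (begin
    + length u              ≡⟨ ℤₚ.*-identityˡ (+ length u) ⟨
    + 1 * + length u        ≡⟨ sumMap-const (+ 1) u ⟨
    sumMap (λ _ → + 1) u    ≡⟨ sumMap-∼₁ (λ _ → + 1) {u} {v} u∼v ⟩
    sumMap (λ _ → + 1) v    ≡⟨ sumMap-const (+ 1) v ⟩
    + 1 * + length v        ≡⟨ ℤₚ.*-identityˡ (+ length v) ⟩
    + length v              ∎)
    where open ≡-Reasoning

  binom-++ : ∀ (u v x : Word m) →
             + binom (u ++ v) x ≡ sumTo (λ i → + binom u (take i x) * + binom v (drop i x)) (suc (length x))
  binom-++ u       v []      = refl
  binom-++ []      v (b ∷ x) =
    sym (trans (cong₂ _+_ (ℤₚ.*-identityˡ P) (sumTo-zero (suc (length x)) (λ _ _ → refl))) (ℤₚ.+-identityʳ P))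
    where P = + binom v (b ∷ x)
  binom-++ (a ∷ u) v (b ∷ x) = begin
    + binom (a ∷ u ++ v) (b ∷ x)
      ≡⟨ binom-∷ a b (u ++ v) x ⟩
    𝟙 b a * + binom (u ++ v) x + + binom (u ++ v) (b ∷ x)
      ≡⟨ cong₂ (λ p q → 𝟙 b a * p + q) (binom-++ u v x) (binom-++ u v (b ∷ x)) ⟩
    𝟙 b a * sumTo F (suc (length x)) + (+ 1 * P + sumTo G (suc (length x)))
      ≡⟨ ring (𝟙 b a) (sumTo F (suc (length x))) (+ 1 * P) (sumTo G (suc (length x))) ⟩
    + 1 * P + (𝟙 b a * sumTo F (suc (length x)) + sumTo G (suc (length x)))
      ≡⟨ cong (_+_ (+ 1 * P)) (sumTo-linear (𝟙 b a) F G (suc (length x))) ⟨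
    + 1 * P + sumTo (λ i → 𝟙 b a * F i + G i) (suc (length x))
      ≡⟨ cong (_+_ (+ 1 * P)) (sumTo-cong (suc (length x)) (λ i _ → expand i)) ⟩
    + 1 * P + sumTo (λ i → + binom (a ∷ u) (b ∷ take i x) * + binom v (drop i x)) (suc (length x)) ∎
    where
    open ≡-Reasoning
    F G : ℕ → ℤ
    F i = + binom u (take i x) * + binom v (drop i x)
    G i = + binom u (b ∷ take i x) * + binom v (drop i x)
    P = + binom v (b ∷ x)
    ring : ∀ c s p t → c * s + (p + t) ≡ p + (c * s + t)
    ring = solve-∀
    expand : ∀ i → 𝟙 b a * F i + G i ≡ + binom (a ∷ u) (b ∷ take i x) * + binom v (drop i x)
    expand i = trans (distrib (𝟙 b a) _ _ _) (cong (_* + binom v (drop i x)) (sym (binom-∷ a b u (take i x))))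
      where distrib : ∀ c p q r → c * (p * r) + q * r ≡ (c * p + q) * r
            distrib = solve-∀

insert-∼₁ : ∀ {m} (γ γ′ δ δ′ v v′ : Word m) →
            (γ ++ δ) ∼₁ (γ′ ++ δ′) → v ∼₁ v′ → (γ ++ v ++ δ) ∼₁ (γ′ ++ v′ ++ δ′)
insert-∼₁ γ γ′ δ δ′ v v′ γδ∼γ′δ′ v∼v′ e = begin
  count e (γ ++ v ++ δ)                       ≡⟨ count-++ e γ (v ++ δ) ⟩
  count e γ ℕ.+ count e (v ++ δ)             ≡⟨ cong (count e γ ℕ.+_) (count-++ e v δ) ⟩
  count e γ ℕ.+ (count e v ℕ.+ count e δ)    ≡⟨ x∙yz≈y∙xz (count e γ) (count e v) (count e δ) ⟩
  count e v ℕ.+ (count e γ ℕ.+ count e δ)    ≡⟨ cong₂ ℕ._+_ (v∼v′ e)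
                                                  (trans (sym (count-++ e γ δ)) (trans (γδ∼γ′δ′ e) (count-++ e γ′ δ′))) ⟩
  count e v′ ℕ.+ (count e γ′ ℕ.+ count e δ′) ≡⟨ x∙yz≈y∙xz (count e v′) (count e γ′) (count e δ′) ⟩
  count e γ′ ℕ.+ (count e v′ ℕ.+ count e δ′) ≡⟨ cong (count e γ′ ℕ.+_) (count-++ e v′ δ′) ⟨
  count e γ′ ℕ.+ count e (v′ ++ δ′)          ≡⟨ count-++ e γ′ (v′ ++ δ′) ⟨
  count e (γ′ ++ v′ ++ δ′)                    ∎
  where open ≡-Reasoning

module _ {m : ℕ} where

  infix 4 _∼[_]_
  _∼[_]_ : Word m → ℕ → Word m → Set
  u ∼[ N ] v = ∀ y → length y ≤ N → binom u y ≡ binom v y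

  Δbinom : Word m → Word m → Word m → ℤ
  Δbinom u u′ x = + binom u x - + binom u′ x

  ∼-++ : ∀ {N} {u u′ v v′ : Word m} → u ∼[ N ] u′ → v ∼[ N ] v′ → u ++ v ∼[ N ] u′ ++ v′
  ∼-++ {N} {u} {u′} {v} {v′} u∼u′ v∼v′ y |y|≤N = ℤₚ.+-injective (begin
    + binom (u ++ v) y
      ≡⟨ binom-++ u v y ⟩
    sumTo (λ i → + binom u (take i y) * + binom v (drop i y)) (suc (length y))
      ≡⟨ sumTo-cong (suc (length y)) (λ i _ → cong₂ (λ p q → + p * + q)
           (u∼u′ (take i y) (ℕₚ.≤-trans (length-take-≤ʳ i y) |y|≤N))
           (v∼v′ (drop i y) (ℕₚ.≤-trans (length-drop-≤ i y) |y|≤N))) ⟩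
    sumTo (λ i → + binom u′ (take i y) * + binom v′ (drop i y)) (suc (length y))
      ≡⟨ binom-++ u′ v′ y ⟨
    + binom (u′ ++ v′) y ∎)
    where open ≡-Reasoning

  binom-++-∼ˡ : ∀ {N} {u u′ : Word m} → u ∼[ N ] u′ → ∀ v x j → length x ≡ j ℕ.+ N →
    Δbinom (u ++ v) (u′ ++ v) x
      ≡ sumTo (λ t → Δbinom u u′ (take (t ℕ.+ suc N) x) * + binom v (drop (t ℕ.+ suc N) x)) j
  binom-++-∼ˡ {N} {u} {u′} u∼u′ v x j |x|≡j+N = begin
    Δbinom (u ++ v) (u′ ++ v) x
      ≡⟨ cong₂ _-_ (binom-++ u v x) (binom-++ u′ v x) ⟩
    sumTo (F u) (suc (length x)) - sumTo (F u′) (suc (length x))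
      ≡⟨ sumTo-- (F u) (F u′) (suc (length x)) ⟨
    sumTo D (suc (length x))
      ≡⟨ cong (sumTo D ∘ suc) (trans |x|≡j+N (ℕₚ.+-comm j N)) ⟩
    sumTo D (suc N ℕ.+ j)
      ≡⟨ sumTo-split D (suc N) j ⟩
    sumTo D (suc N) + sumTo (λ t → D (suc N ℕ.+ t)) j
      ≡⟨ cong₂ _+_ (sumTo-zero (suc N) short) (sumTo-cong j (λ t _ → long t)) ⟩
    + 0 + sumTo (λ t → Δbinom u u′ (take (t ℕ.+ suc N) x) * + binom v (drop (t ℕ.+ suc N) x)) j
      ≡⟨ ℤₚ.+-identityˡ _ ⟩
    sumTo (λ t → Δbinom u u′ (take (t ℕ.+ suc N) x) * + binom v (drop (t ℕ.+ suc N) x)) j ∎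
    where
    open ≡-Reasoning
    F : Word m → ℕ → ℤ
    F w i = + binom w (take i x) * + binom v (drop i x)
    D : ℕ → ℤ
    D i = F u i - F u′ i
    short : ∀ i → i < suc N → D i ≡ + 0
    short i (s≤s i≤N) = trans (cong (λ k → + k * + binom v (drop i x) - F u′ i)
                                    (u∼u′ (take i x) (ℕₚ.≤-trans (length-take-≤ˡ i x) i≤N)))
                              (ℤₚ.+-inverseʳ (F u′ i))
    long : ∀ t → D (suc N ℕ.+ t) ≡ Δbinom u u′ (take (t ℕ.+ suc N) x) * + binom v (drop (t ℕ.+ suc N) x)
    long t = trans (cong D (ℕₚ.+-comm (suc N) t))
                   (ring (+ binom u (take i x)) (+ binom u′ (take i x)) (+ binom v (drop i x)))
      where
      i = t ℕ.+ suc N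
      ring : ∀ a b c → a * c - b * c ≡ (a - b) * c
      ring = solve-∀

  binom-++-∼ʳ : ∀ {N} {v v′ : Word m} → v ∼[ N ] v′ → ∀ u x j → length x ≡ j ℕ.+ N →
    Δbinom (u ++ v) (u ++ v′) x ≡ sumTo (λ i → + binom u (take i x) * Δbinom v v′ (drop i x)) j
  binom-++-∼ʳ {N} {v} {v′} v∼v′ u x j |x|≡j+N = begin
    Δbinom (u ++ v) (u ++ v′) x
      ≡⟨ cong₂ _-_ (binom-++ u v x) (binom-++ u v′ x) ⟩
    sumTo (G v) (suc (length x)) - sumTo (G v′) (suc (length x))
      ≡⟨ sumTo-- (G v) (G v′) (suc (length x)) ⟨
    sumTo D (suc (length x))
      ≡⟨ cong (sumTo D) (trans (cong suc |x|≡j+N) (sym (ℕₚ.+-suc j N))) ⟩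
    sumTo D (j ℕ.+ suc N)
      ≡⟨ sumTo-split D j (suc N) ⟩
    sumTo D j + sumTo (λ t → D (j ℕ.+ t)) (suc N)
      ≡⟨ cong₂ _+_ (sumTo-cong j (λ i _ → ring (+ binom u (take i x)) (+ binom v (drop i x)) (+ binom v′ (drop i x))))
                   (sumTo-zero (suc N) short) ⟩
    sumTo (λ i → + binom u (take i x) * Δbinom v v′ (drop i x)) j + + 0
      ≡⟨ ℤₚ.+-identityʳ _ ⟩
    sumTo (λ i → + binom u (take i x) * Δbinom v v′ (drop i x)) j ∎
    where
    open ≡-Reasoning
    G : Word m → ℕ → ℤ
    G w i = + binom u (take i x) * + binom w (drop i x)
    D : ℕ → ℤ
    D i = G v i - G v′ i
    ring : ∀ a b c → a * b - a * c ≡ a * (b - c)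
    ring = solve-∀
    short : ∀ t → t < suc N → D (j ℕ.+ t) ≡ + 0
    short t _ = trans (cong (λ k → + binom u (take (j ℕ.+ t) x) * + k - G v′ (j ℕ.+ t))
                            (v∼v′ (drop (j ℕ.+ t) x) |drop|≤N))
                      (ℤₚ.+-inverseʳ (G v′ (j ℕ.+ t)))
      where
      |drop|≤N : length (drop (j ℕ.+ t) x) ≤ N
      |drop|≤N = ℕₚ.≤-trans
        (ℕₚ.≤-reflexive (trans (Listₚ.length-drop (j ℕ.+ t) x)
                         (trans (cong (_∸ (j ℕ.+ t)) |x|≡j+N) (ℕₚ.[m+n]∸[m+o]≡n∸o j N t))))
        (ℕₚ.m∸n≤m N t)

  binom-++-Δ₁ : ∀ {N} {u u′ v v′ : Word m} → u ∼[ N ] u′ → v ∼[ N ] v′ → ∀ x → length x ≡ suc N →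
    Δbinom (u ++ v) (u′ ++ v′) x ≡ Δbinom u u′ x + Δbinom v v′ x
  binom-++-Δ₁ {N} {u} {u′} {v} {v′} u∼u′ v∼v′ x |x|≡1+N = begin
    Δbinom (u ++ v) (u′ ++ v′) x
      ≡⟨ telescope (+ binom (u ++ v) x) (+ binom (u′ ++ v) x) (+ binom (u′ ++ v′) x) ⟩
    Δbinom (u ++ v) (u′ ++ v) x + Δbinom (u′ ++ v) (u′ ++ v′) x
      ≡⟨ cong₂ _+_ (binom-++-∼ˡ u∼u′ v x 1 |x|≡1+N) (binom-++-∼ʳ v∼v′ u′ x 1 |x|≡1+N) ⟩
    (Δbinom u u′ (take (suc N) x) * + binom v (drop (suc N) x) + + 0) + (+ 1 * Δbinom v v′ x + + 0)
      ≡⟨ cong₂ (λ p s → (Δbinom u u′ p * + binom v s + + 0) + (+ 1 * Δbinom v v′ x + + 0))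
               (Listₚ.take-all (suc N) x |x|≤1+N) (Listₚ.drop-all (suc N) x |x|≤1+N) ⟩
    (Δbinom u u′ x * + 1 + + 0) + (+ 1 * Δbinom v v′ x + + 0)
      ≡⟨ ring (Δbinom u u′ x) (Δbinom v v′ x) ⟩
    Δbinom u u′ x + Δbinom v v′ x ∎
    where
    open ≡-Reasoning
    |x|≤1+N = ℕₚ.≤-reflexive |x|≡1+N
    telescope : ∀ a b c → a - c ≡ (a - b) + (b - c)
    telescope = solve-∀
    ring : ∀ a b → (a * + 1 + + 0) + (+ 1 * b + + 0) ≡ a + b
    ring = solve-∀

  binom-++-Δ₂ : ∀ {N} {u u′ v v′ : Word m} → u ∼[ N ] u′ → v ∼[ N ] v′ → ∀ x → length x ≡ 2 ℕ.+ N →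
    Δbinom (u ++ v) (u′ ++ v′) x
      ≡ Δbinom u u′ x + Δbinom v v′ x
        + Δbinom u u′ (take (suc N) x) * + binom v (drop (suc N) x)
        + + binom u′ (take 1 x) * Δbinom v v′ (drop 1 x)
  binom-++-Δ₂ {N} {u} {u′} {v} {v′} u∼u′ v∼v′ x |x|≡2+N = begin
    Δbinom (u ++ v) (u′ ++ v′) x
      ≡⟨ telescope (+ binom (u ++ v) x) (+ binom (u′ ++ v) x) (+ binom (u′ ++ v′) x) ⟩
    Δbinom (u ++ v) (u′ ++ v) x + Δbinom (u′ ++ v) (u′ ++ v′) x
      ≡⟨ cong₂ _+_ (binom-++-∼ˡ u∼u′ v x 2 |x|≡2+N) (binom-++-∼ʳ v∼v′ u′ x 2 |x|≡2+N) ⟩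
    (Δu₁ * + binom v x₂ + (Δbinom u u′ (take (2 ℕ.+ N) x) * + binom v (drop (2 ℕ.+ N) x) + + 0))
      + (+ 1 * Δbinom v v′ x + (+ binom u′ (take 1 x) * Δbinom v v′ (drop 1 x) + + 0))
      ≡⟨ cong₂ (λ p s → (Δu₁ * + binom v x₂ + (Δbinom u u′ p * + binom v s + + 0))
                        + (+ 1 * Δbinom v v′ x + (+ binom u′ (take 1 x) * Δbinom v v′ (drop 1 x) + + 0)))
               (Listₚ.take-all (2 ℕ.+ N) x |x|≤2+N) (Listₚ.drop-all (2 ℕ.+ N) x |x|≤2+N) ⟩
    (Δu₁ * + binom v x₂ + (Δbinom u u′ x * + 1 + + 0))
      + (+ 1 * Δbinom v v′ x + (+ binom u′ (take 1 x) * Δbinom v v′ (drop 1 x) + + 0))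
      ≡⟨ ring (Δbinom u u′ x) (Δbinom v v′ x) (Δu₁ * + binom v x₂) (+ binom u′ (take 1 x) * Δbinom v v′ (drop 1 x)) ⟩
    Δbinom u u′ x + Δbinom v v′ x + Δu₁ * + binom v x₂ + + binom u′ (take 1 x) * Δbinom v v′ (drop 1 x) ∎
    where
    open ≡-Reasoning
    x₂ = drop (suc N) x
    Δu₁ = Δbinom u u′ (take (suc N) x)
    |x|≤2+N = ℕₚ.≤-reflexive |x|≡2+N
    telescope : ∀ a b c → a - c ≡ (a - b) + (b - c)
    telescope = solve-∀
    ring : ∀ a b c d → (c + (a * + 1 + + 0)) + (+ 1 * b + (d + + 0)) ≡ a + b + c + d
    ring = solve-∀

pairSum : {A : Set} → (A → A → ℤ) → List A → ℤ
pairSum h []      = + 0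
pairSum h (a ∷ w) = sumMap (h a) w + pairSum h w

C2-suc : ∀ n → suc n C 2 ≡ n ℕ.+ n C 2
C2-suc n = trans (sym (nCk+nC[k+1]≡[n+1]C[k+1] n 1)) (cong (ℕ._+ n C 2) (nC1≡n n))

module _ {A : Set} where

  sumMap-swap : ∀ {I : Set} (g : I → A → ℤ) is w →
                sumMap (λ i → sumMap (g i) w) is ≡ sumMap (λ b → sumMap (λ i → g i b) is) w
  sumMap-swap g is []      = sumMap-const (+ 0) is
  sumMap-swap g is (b ∷ w) = trans (sumMap-+ (λ i → g i b) (λ i → sumMap (g i) w) is)
                                   (cong (_+_ (sumMap (λ i → g i b) is)) (sumMap-swap g is w))

  sumMap-sumMap-+ : ∀ (f g : A → ℤ) x y →
    sumMap (λ a → sumMap (λ b → f a + g b) y) x ≡ sumMap f x * + length y + + length x * sumMap g y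
  sumMap-sumMap-+ f g x y = begin
    sumMap (λ a → sumMap (λ b → f a + g b) y) x
      ≡⟨ sumMap-cong (λ a → trans (sumMap-+ (λ _ → f a) g y) (cong (_+ sumMap g y) (sumMap-const (f a) y))) x ⟩
    sumMap (λ a → f a * + length y + sumMap g y) x
      ≡⟨ sumMap-+ (λ a → f a * + length y) (λ _ → sumMap g y) x ⟩
    sumMap (λ a → f a * + length y) x + sumMap (λ _ → sumMap g y) x
      ≡⟨ cong₂ _+_ (trans (sumMap-cong (λ a → ℤₚ.*-comm (f a) (+ length y)) x) (sumMap-*ˡ (+ length y) f x))
                   (sumMap-const (sumMap g y) x) ⟩
    + length y * sumMap f x + sumMap g y * + length x
      ≡⟨ cong₂ _+_ (ℤₚ.*-comm (+ length y) (sumMap f x)) (ℤₚ.*-comm (sumMap g y) (+ length x)) ⟩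
    sumMap f x * + length y + + length x * sumMap g y ∎
    where open ≡-Reasoning

  pairSum-cong : ∀ {h h′ : A → A → ℤ} → (∀ a b → h a b ≡ h′ a b) → ∀ w → pairSum h w ≡ pairSum h′ w
  pairSum-cong h≗h′ []      = refl
  pairSum-cong h≗h′ (a ∷ w) = cong₂ _+_ (sumMap-cong (h≗h′ a) w) (pairSum-cong h≗h′ w)

  pairSum-+ : ∀ (h h′ : A → A → ℤ) w → pairSum (λ a b → h a b + h′ a b) w ≡ pairSum h w + pairSum h′ w
  pairSum-+ h h′ []      = refl
  pairSum-+ h h′ (a ∷ w) = trans (cong₂ _+_ (sumMap-+ (h a) (h′ a) w) (pairSum-+ h h′ w))
                                 (ring (sumMap (h a) w) (sumMap (h′ a) w) (pairSum h w) (pairSum h′ w))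
    where ring : ∀ p q r s → (p + q) + (r + s) ≡ (p + r) + (q + s)
          ring = solve-∀

  pairSum-sumMap : ∀ {I : Set} (h : I → A → A → ℤ) is w →
                   sumMap (λ i → pairSum (h i) w) is ≡ pairSum (λ a b → sumMap (λ i → h i a b) is) w
  pairSum-sumMap h is []      = sumMap-const (+ 0) is
  pairSum-sumMap h is (a ∷ w) =
    trans (sumMap-+ (λ i → sumMap (h i a) w) (λ i → pairSum (h i) w) is)
          (cong₂ _+_ (sumMap-swap (λ i → h i a) is w) (pairSum-sumMap h is w))

  pairSum-affine : ∀ κ λ′ (h : A → A → ℤ) w →
                   pairSum (λ a b → κ + λ′ * h a b) w ≡ κ * + (length w C 2) + λ′ * pairSum h w
  pairSum-affine κ λ′ h []      = sym (cong₂ _+_ (ℤₚ.*-zeroʳ κ) (ℤₚ.*-zeroʳ λ′))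
  pairSum-affine κ λ′ h (a ∷ w) = begin
    sumMap (λ b → κ + λ′ * h a b) w + pairSum (λ a b → κ + λ′ * h a b) w
      ≡⟨ cong₂ _+_ (trans (sumMap-+ (λ _ → κ) (λ b → λ′ * h a b) w)
                          (cong₂ _+_ (sumMap-const κ w) (sumMap-*ˡ λ′ (h a) w)))
                   (pairSum-affine κ λ′ h w) ⟩
    (κ * + length w + λ′ * sumMap (h a) w) + (κ * + (length w C 2) + λ′ * pairSum h w)
      ≡⟨ ring κ λ′ (+ length w) (+ (length w C 2)) (sumMap (h a) w) (pairSum h w) ⟩
    κ * (+ length w + + (length w C 2)) + λ′ * (sumMap (h a) w + pairSum h w)
      ≡⟨ cong (λ k → κ * k + λ′ * (sumMap (h a) w + pairSum h w)) (cong +_ (sym (C2-suc (length w)))) ⟩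
    κ * + (suc (length w) C 2) + λ′ * (sumMap (h a) w + pairSum h w) ∎
    where
    open ≡-Reasoning
    ring : ∀ κ λ′ l c s p → (κ * l + λ′ * s) + (κ * c + λ′ * p) ≡ κ * (l + c) + λ′ * (s + p)
    ring = solve-∀

  pairSum-++ : ∀ (h : A → A → ℤ) x y →
               pairSum h (x ++ y) ≡ pairSum h x + pairSum h y + sumMap (λ a → sumMap (h a) y) x
  pairSum-++ h []      y = ring (pairSum h y)
    where ring : ∀ p → p ≡ + 0 + p + + 0
          ring = solve-∀
  pairSum-++ h (c ∷ x) y = begin
    sumMap (h c) (x ++ y) + pairSum h (x ++ y)
      ≡⟨ cong₂ _+_ (sumMap-++ (h c) x y) (pairSum-++ h x y) ⟩
    (sumMap (h c) x + sumMap (h c) y) + (pairSum h x + pairSum h y + sumMap (λ a → sumMap (h a) y) x)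
      ≡⟨ ring (sumMap (h c) x) (sumMap (h c) y) (pairSum h x) (pairSum h y) (sumMap (λ a → sumMap (h a) y) x) ⟩
    (sumMap (h c) x + pairSum h x) + pairSum h y + (sumMap (h c) y + sumMap (λ a → sumMap (h a) y) x) ∎
    where
    open ≡-Reasoning
    ring : ∀ p q r s t → (p + q) + (r + s + t) ≡ (p + r) + s + (q + t)
    ring = solve-∀

  pairSum-rotate : ∀ (h : A → A → ℤ) a t → pairSum h (t ++ [ a ]) - pairSum h (a ∷ t) ≡ sumMap (λ b → h b a - h a b) t
  pairSum-rotate h a t = begin
    pairSum h (t ++ [ a ]) - pairSum h (a ∷ t)
      ≡⟨ cong (_- pairSum h (a ∷ t)) (pairSum-++ h t [ a ]) ⟩
    pairSum h t + (+ 0 + + 0) + sumMap (λ b → h b a + + 0) t - (sumMap (h a) t + pairSum h t)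
      ≡⟨ cong (λ s → pairSum h t + (+ 0 + + 0) + s - (sumMap (h a) t + pairSum h t))
              (sumMap-cong (λ b → ℤₚ.+-identityʳ (h b a)) t) ⟩
    pairSum h t + (+ 0 + + 0) + sumMap (λ b → h b a) t - (sumMap (h a) t + pairSum h t)
      ≡⟨ ring (pairSum h t) (sumMap (λ b → h b a) t) (sumMap (h a) t) ⟩
    sumMap (λ b → h b a) t - sumMap (h a) t
      ≡⟨ sumMap-- (λ b → h b a) (h a) t ⟨
    sumMap (λ b → h b a - h a b) t ∎
    where
    open ≡-Reasoning
    ring : ∀ p s s′ → p + (+ 0 + + 0) + s - (s′ + p) ≡ s - s′
    ring = solve-∀

binom-pair : ∀ {m} (e f : Letter m) v → + binom v (e ∷ f ∷ []) ≡ pairSum (λ a b → 𝟙 e a * 𝟙 f b) v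
binom-pair e f []      = refl
binom-pair e f (c ∷ v) = begin
  + binom (c ∷ v) (e ∷ f ∷ [])
    ≡⟨ binom-∷ c e v [ f ] ⟩
  𝟙 e c * + binom v [ f ] + + binom v (e ∷ f ∷ [])
    ≡⟨ cong₂ (λ p q → 𝟙 e c * p + q) (trans (cong +_ (binom-letter f v)) (sym (sumMap-𝟙 f v))) (binom-pair e f v) ⟩
  𝟙 e c * sumMap (𝟙 f) v + pairSum (λ a b → 𝟙 e a * 𝟙 f b) v
    ≡⟨ cong (_+ pairSum (λ a b → 𝟙 e a * 𝟙 f b) v) (sumMap-*ˡ (𝟙 e c) (𝟙 f) v) ⟨
  sumMap (λ b → 𝟙 e c * 𝟙 f b) v + pairSum (λ a b → 𝟙 e a * 𝟙 f b) v ∎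
  where open ≡-Reasoning

binom-concatMap-letter : ∀ {m} {A : Set} (B : A → Word m) v y → length y ≡ 1 →
                         + binom (concatMap B v) y ≡ sumMap (λ a → + binom (B a) y) v
binom-concatMap-letter B []      (e ∷ []) _ = refl
binom-concatMap-letter B (a ∷ v) (e ∷ []) _ = begin
  + binom (B a ++ concatMap B v) [ e ]                ≡⟨ cong +_ (binom-letter e (B a ++ concatMap B v)) ⟩
  + count e (B a ++ concatMap B v)                    ≡⟨ cong +_ (count-++ e (B a) (concatMap B v)) ⟩
  + count e (B a) + + count e (concatMap B v)         ≡⟨ cong₂ (λ p q → + p + q) (sym (binom-letter e (B a)))
                                                               (trans (cong +_ (sym (binom-letter e (concatMap B v))))
                                                                      (binom-concatMap-letter B v [ e ] refl)) ⟩
  + binom (B a) [ e ] + sumMap (λ b → + binom (B b) [ e ]) v ∎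
  where open ≡-Reasoning

module Blocks {m : ℕ} {A : Set} (B : A → Word m) (N : ℕ) (B-∼ : ∀ a a′ → B a ∼[ N ] B a′) where

  T : Word m → A → ℤ
  T x a = + binom (B a) x

  concatMap-∼ : ∀ (w w′ : List A) → length w ≡ length w′ → concatMap B w ∼[ N ] concatMap B w′
  concatMap-∼ []      []       _   = λ _ _ → refl
  concatMap-∼ (a ∷ w) (a′ ∷ w′) |w| = ∼-++ (B-∼ a a′) (concatMap-∼ w w′ (ℕₚ.suc-injective |w|))

  concatMap-Δ₁ : ∀ (w w′ : List A) → length w ≡ length w′ → ∀ x → length x ≡ suc N →
    Δbinom (concatMap B w) (concatMap B w′) x ≡ sumMap (T x) w - sumMap (T x) w′
  concatMap-Δ₁ []      []       _   x _ = ℤₚ.+-inverseʳ (+ binom [] x)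
  concatMap-Δ₁ (a ∷ w) (a′ ∷ w′) |w| x |x| = begin
    Δbinom (B a ++ concatMap B w) (B a′ ++ concatMap B w′) x
      ≡⟨ binom-++-Δ₁ (B-∼ a a′) (concatMap-∼ w w′ (ℕₚ.suc-injective |w|)) x |x| ⟩
    (T x a - T x a′) + Δbinom (concatMap B w) (concatMap B w′) x
      ≡⟨ cong (_+_ (T x a - T x a′)) (concatMap-Δ₁ w w′ (ℕₚ.suc-injective |w|) x |x|) ⟩
    (T x a - T x a′) + (sumMap (T x) w - sumMap (T x) w′)
      ≡⟨ ring (T x a) (T x a′) (sumMap (T x) w) (sumMap (T x) w′) ⟩
    (T x a + sumMap (T x) w) - (T x a′ + sumMap (T x) w′) ∎
    where
    open ≡-Reasoning
    ring : ∀ a b c d → (a - b) + (c - d) ≡ (a + c) - (b + d)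
    ring = solve-∀

  -- Occurrences of x split over two blocks as (x without its last letter | last letter) or
  -- (first letter | the rest); all other splittings do not see which blocks occur.
  kernel : Word m → A → A → ℤ
  kernel x a b = T (take (suc N) x) a * T (drop (suc N) x) b + T (take 1 x) a * T (drop 1 x) b

  blockSum : Word m → List A → ℤ
  blockSum x w = sumMap (T x) w + pairSum (kernel x) w

  blockSum-∷ : ∀ x a w → blockSum x (a ∷ w) ≡ T x a + T (take (suc N) x) a * sumMap (T (drop (suc N) x)) w
                                                   + T (take 1 x) a * sumMap (T (drop 1 x)) w + blockSum x w
  blockSum-∷ x a w = begin
    (T x a + sumMap (T x) w) + (sumMap (kernel x a) w + pairSum (kernel x) w)
      ≡⟨ cong (λ k → (T x a + sumMap (T x) w) + (k + pairSum (kernel x) w))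
              (trans (sumMap-+ (λ b → T x₁ a * T x₂ b) (λ b → T x₀ a * T x₋ b) w)
                     (cong₂ _+_ (sumMap-*ˡ (T x₁ a) (T x₂) w) (sumMap-*ˡ (T x₀ a) (T x₋) w))) ⟩
    (T x a + sumMap (T x) w) + (T x₁ a * sumMap (T x₂) w + T x₀ a * sumMap (T x₋) w + pairSum (kernel x) w)
      ≡⟨ ring (T x a) (sumMap (T x) w) (T x₁ a * sumMap (T x₂) w) (T x₀ a * sumMap (T x₋) w) (pairSum (kernel x) w) ⟩
    T x a + T x₁ a * sumMap (T x₂) w + T x₀ a * sumMap (T x₋) w + blockSum x w ∎
    where
    open ≡-Reasoning
    x₀ = take 1 x
    x₋ = drop 1 x
    x₁ = take (suc N) x
    x₂ = drop (suc N) x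
    ring : ∀ t s p q r → (t + s) + (p + q + r) ≡ t + p + q + (s + r)
    ring = solve-∀

  sumMap-T-short : ∀ (w w′ : List A) → length w ≡ length w′ → ∀ y → length y ≤ N → sumMap (T y) w ≡ sumMap (T y) w′
  sumMap-T-short []      []       _   y _     = refl
  sumMap-T-short (a ∷ w) (a′ ∷ w′) |w| y |y|≤N =
    cong₂ _+_ (cong +_ (B-∼ a a′ y |y|≤N)) (sumMap-T-short w w′ (ℕₚ.suc-injective |w|) y |y|≤N)

  concatMap-Δ₂ : 1 ≤ N → ∀ (w w′ : List A) → length w ≡ length w′ → ∀ x → length x ≡ 2 ℕ.+ N →
    Δbinom (concatMap B w) (concatMap B w′) x ≡ blockSum x w - blockSum x w′
  concatMap-Δ₂ _   []      []       _   x _   = ℤₚ.+-inverseʳ (+ binom [] x)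
  concatMap-Δ₂ 1≤N (c ∷ v) (c′ ∷ v′) |w| x |x| = begin
    Δbinom (B c ++ W v) (B c′ ++ W v′) x
      ≡⟨ binom-++-Δ₂ (B-∼ c c′) (concatMap-∼ v v′ |v|) x |x| ⟩
    (T x c - T x c′) + Δbinom (W v) (W v′) x + (T x₁ c - T x₁ c′) * + binom (W v) x₂
      + T x₀ c′ * Δbinom (W v) (W v′) x₋
      ≡⟨ cong₂ (λ p q → (T x c - T x c′) + p + (T x₁ c - T x₁ c′) * q + T x₀ c′ * Δbinom (W v) (W v′) x₋)
               (concatMap-Δ₂ 1≤N v v′ |v| x |x|) (binom-concatMap-letter B v x₂ |x₂|) ⟩
    (T x c - T x c′) + (blockSum x v - blockSum x v′) + (T x₁ c - T x₁ c′) * S₂ v + T x₀ c′ * Δbinom (W v) (W v′) x₋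
      ≡⟨ cong (λ d → (T x c - T x c′) + (blockSum x v - blockSum x v′) + (T x₁ c - T x₁ c′) * S₂ v + T x₀ c′ * d)
              (concatMap-Δ₁ v v′ |v| x₋ |x₋|) ⟩
    (T x c - T x c′) + (blockSum x v - blockSum x v′) + (T x₁ c - T x₁ c′) * S₂ v + T x₀ c′ * (S₋ v - S₋ v′)
      ≡⟨ ring (T x c) (T x c′) (blockSum x v) (blockSum x v′) (T x₁ c) (T x₁ c′) (S₂ v) (T x₀ c′) (S₋ v) (S₋ v′) ⟩
    (T x c + T x₁ c * S₂ v + T x₀ c′ * S₋ v + blockSum x v) - (T x c′ + T x₁ c′ * S₂ v + T x₀ c′ * S₋ v′ + blockSum x v′)
      ≡⟨ cong₂ (λ t s → (T x c + T x₁ c * S₂ v + t * S₋ v + blockSum x v)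
                        - (T x c′ + T x₁ c′ * s + T x₀ c′ * S₋ v′ + blockSum x v′))
               (cong +_ (B-∼ c′ c x₀ (ℕₚ.≤-trans (length-take-≤ˡ 1 x) 1≤N)))
               (sumMap-T-short v v′ |v| x₂ (ℕₚ.≤-trans (ℕₚ.≤-reflexive |x₂|) 1≤N)) ⟩
    (T x c + T x₁ c * S₂ v + T x₀ c * S₋ v + blockSum x v) - (T x c′ + T x₁ c′ * S₂ v′ + T x₀ c′ * S₋ v′ + blockSum x v′)
      ≡⟨ cong₂ _-_ (blockSum-∷ x c v) (blockSum-∷ x c′ v′) ⟨
    blockSum x (c ∷ v) - blockSum x (c′ ∷ v′) ∎
    where
    open ≡-Reasoning
    W = concatMap B
    x₀ = take 1 x
    x₋ = drop 1 x
    x₁ = take (suc N) x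
    x₂ = drop (suc N) x
    S₂ S₋ : List A → ℤ
    S₂ = sumMap (T x₂)
    S₋ = sumMap (T x₋)
    |v| = ℕₚ.suc-injective |w|
    |x₋| : length x₋ ≡ suc N
    |x₋| = trans (Listₚ.length-drop 1 x) (cong (_∸ 1) |x|)
    |x₂| : length x₂ ≡ 1
    |x₂| = trans (Listₚ.length-drop (suc N) x) (trans (cong (_∸ suc N) |x|) (ℕₚ.m+n∸n≡m 1 (suc N)))
    ring : ∀ t t′ φ φ′ t₁ t₁′ s₂ t₀ s s′ →
           (t - t′) + (φ - φ′) + (t₁ - t₁′) * s₂ + t₀ * (s - s′)
             ≡ (t + t₁ * s₂ + t₀ * s + φ) - (t′ + t₁′ * s₂ + t₀ * s′ + φ′)
    ring = solve-∀

concatMap-∼₁ : ∀ {m m′ N} (B : Letter m′ → Word m) → (∀ a a′ → B a ∼[ N ] B a′) →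
               ∀ {w w′} → w ∼₁ w′ → concatMap B w ∼[ suc N ] concatMap B w′
concatMap-∼₁ {N = N} B B-∼ {w} {w′} w∼w′ y |y|≤1+N with ℕₚ.m≤n⇒m<n∨m≡n |y|≤1+N
... | inj₁ (s≤s |y|≤N) = concatMap-∼ w w′ (length-∼₁ {u = w} {w′} w∼w′) y |y|≤N
  where open Blocks B N B-∼
... | inj₂ |y|≡1+N     = ℤₚ.+-injective (ℤₚ.i-j≡0⇒i≡j _ _ (begin
  Δbinom (concatMap B w) (concatMap B w′) y  ≡⟨ concatMap-Δ₁ w w′ (length-∼₁ {u = w} {w′} w∼w′) y |y|≡1+N ⟩
  sumMap (T y) w - sumMap (T y) w′           ≡⟨ cong (_- sumMap (T y) w′) (sumMap-∼₁ (T y) {w} {w′} w∼w′) ⟩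
  sumMap (T y) w′ - sumMap (T y) w′          ≡⟨ ℤₚ.+-inverseʳ (sumMap (T y) w′) ⟩
  + 0                                        ∎))
  where
  open Blocks B N B-∼
  open ≡-Reasoning

module Alphabet (n : ℕ) where

  m : ℕ
  m = suc (suc n)

  0ₘ -1ₘ : Letter m
  0ₘ  = letter m 0
  -1ₘ = neg m (letter m 1)

  sucₘ : Letter m → Letter m
  sucₘ a = letter m (suc (toℕ a))

  toℕ-letter : ∀ x → toℕ (letter m x) ≡ x % m
  toℕ-letter x = Finₚ.toℕ-fromℕ< _

  letter-cong : ∀ x y → x % m ≡ y % m → letter m x ≡ letter m y
  letter-cong x y x≡y = Finₚ.toℕ-injective (trans (toℕ-letter x) (trans x≡y (sym (toℕ-letter y))))

  toℕ-letter-< : ∀ {x} → x < m → toℕ (letter m x) ≡ x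
  toℕ-letter-< {x} x<m = trans (toℕ-letter x) (ℕ%.m<n⇒m%n≡m x<m)

  letter-toℕ : ∀ a → letter m (toℕ a) ≡ a
  letter-toℕ a = Finₚ.toℕ-injective (toℕ-letter-< (Finₚ.toℕ<n a))

  %-absorbˡ : ∀ x y → (x % m ℕ.+ y) % m ≡ (x ℕ.+ y) % m
  %-absorbˡ x y = begin
    (x % m ℕ.+ y) % m              ≡⟨ ℕ%.%-distribˡ-+ (x % m) y m ⟩
    (x % m % m ℕ.+ y % m) % m      ≡⟨ cong (λ r → (r ℕ.+ y % m) % m) (ℕ%.m%n%n≡m%n x m) ⟩
    (x % m ℕ.+ y % m) % m          ≡⟨ ℕ%.%-distribˡ-+ x y m ⟨
    (x ℕ.+ y) % m                  ∎
    where open ≡-Reasoning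

  %-absorbʳ : ∀ x y → (x ℕ.+ y % m) % m ≡ (x ℕ.+ y) % m
  %-absorbʳ x y = trans (cong (_% m) (ℕₚ.+-comm x (y % m)))
                        (trans (%-absorbˡ y x) (cong (_% m) (ℕₚ.+-comm y x)))

  toℕ-sucₘ : ∀ a → toℕ (sucₘ a) ≡ suc (toℕ a) % m
  toℕ-sucₘ a = toℕ-letter (suc (toℕ a))

  sucₘ-injective : Injective _≡_ _≡_ sucₘ
  sucₘ-injective {a} {b} sa≡sb =
    Finₚ.toℕ-injective (trans (sym (undo a)) (trans (cong (λ c → (toℕ c ℕ.+ suc n) % m) sa≡sb) (undo b)))
    where
    undo : ∀ a → (toℕ (sucₘ a) ℕ.+ suc n) % m ≡ toℕ a
    undo a = begin
      (toℕ (sucₘ a) ℕ.+ suc n) % m      ≡⟨ cong (λ r → (r ℕ.+ suc n) % m) (toℕ-sucₘ a) ⟩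
      (suc (toℕ a) % m ℕ.+ suc n) % m   ≡⟨ %-absorbˡ (suc (toℕ a)) (suc n) ⟩
      (suc (toℕ a) ℕ.+ suc n) % m       ≡⟨ cong (_% m) (ℕₚ.+-suc (toℕ a) (suc n)) ⟨
      (toℕ a ℕ.+ m) % m                 ≡⟨ ℕ%.[m+n]%n≡m%n (toℕ a) m ⟩
      toℕ a % m                         ≡⟨ ℕ%.m<n⇒m%n≡m (Finₚ.toℕ<n a) ⟩
      toℕ a                             ∎
      where open ≡-Reasoning

  neg-0ₘ : neg m 0ₘ ≡ 0ₘ
  neg-0ₘ = letter-cong m 0 (ℕ%.n%n≡0 m)

  sucₘ-neg : ∀ i → sucₘ (neg m (letter m (suc i))) ≡ neg m (letter m i)
  sucₘ-neg i = letter-cong (suc (toℕ (neg m (letter m (suc i))))) (m ∸ toℕ (letter m i)) (begin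
    suc (toℕ (neg m (letter m (suc i)))) % m
      ≡⟨ cong (λ k → suc k % m) (toℕ-letter (m ∸ toℕ (letter m (suc i)))) ⟩
    (1 ℕ.+ (m ∸ toℕ (letter m (suc i))) % m) % m
      ≡⟨ %-absorbʳ 1 (m ∸ toℕ (letter m (suc i))) ⟩
    suc (m ∸ toℕ (letter m (suc i))) % m
      ≡⟨ cong (λ k → suc (m ∸ k) % m) (trans (toℕ-letter (suc i)) (sym (%-absorbʳ 1 i))) ⟩
    suc (m ∸ suc (i % m) % m) % m
      ≡⟨ wrap (i % m) (ℕ%.m%n<n i m) ⟩
    (m ∸ i % m) % m
      ≡⟨ cong (λ k → (m ∸ k) % m) (toℕ-letter i) ⟨
    (m ∸ toℕ (letter m i)) % m ∎)
    where
    open ≡-Reasoning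
    wrap : ∀ r → r < m → suc (m ∸ suc r % m) % m ≡ (m ∸ r) % m
    wrap r r<m with ℕₚ.m≤n⇒m<n∨m≡n r<m
    ... | inj₁ 1+r<m = trans (cong (λ k → suc (m ∸ k) % m) (ℕ%.m<n⇒m%n≡m 1+r<m))
                             (cong (_% m) (sym (ℕₚ.+-∸-assoc 1 r<m)))
    ... | inj₂ 1+r≡m = begin
      suc (m ∸ suc r % m) % m  ≡⟨ cong (λ k → suc (m ∸ k) % m) (trans (cong (_% m) 1+r≡m) (ℕ%.n%n≡0 m)) ⟩
      (1 ℕ.+ m) % m            ≡⟨ ℕ%.[m+n]%n≡m%n 1 m ⟩
      1 % m                    ≡⟨ cong (_% m) (trans (cong (_∸ r) (sym 1+r≡m)) (ℕₚ.m+n∸n≡m 1 r)) ⟨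
      (m ∸ r) % m              ∎

  sucₘ--1ₘ : sucₘ -1ₘ ≡ 0ₘ
  sucₘ--1ₘ = trans (sucₘ-neg 0) neg-0ₘ

  𝟙-sucₘ : ∀ b → 𝟙 0ₘ (sucₘ b) ≡ 𝟙 -1ₘ b
  𝟙-sucₘ b = trans (cong (λ e → 𝟙 e (sucₘ b)) (sym sucₘ--1ₘ)) (𝟙-injective sucₘ-injective -1ₘ b)

  toℕ--1ₘ : toℕ -1ₘ ≡ suc n
  toℕ--1ₘ = toℕ-letter-< ℕₚ.≤-refl

  -1ₘ≢letter : ∀ {c} → c < suc n → -1ₘ ≢ letter m c
  -1ₘ≢letter {c} c<1+n eq =
    ℕₚ.<-irrefl (trans (sym (toℕ-letter-< (ℕₚ.m<n⇒m<1+n c<1+n))) (trans (cong toℕ (sym eq)) toℕ--1ₘ)) c<1+n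

  0ₘ≢letter : ∀ {c} → suc c < m → 0ₘ ≢ letter m (suc c)
  0ₘ≢letter 1+c<m eq = ℕₚ.0≢1+n (trans (cong toℕ eq) (toℕ-letter-< 1+c<m))

  -- rotation c is σ_m(c mod m), indexed by c ∈ ℕ so that rotation (suc c) is rotation c with
  -- its first letter moved to the end.
  rotation : ℕ → Word m
  rotation c = map (λ j → letter m (c ℕ.+ j)) (upTo m)

  rotation-tail : ℕ → Word m
  rotation-tail c = map (λ j → letter m (suc c ℕ.+ j)) (upTo (suc n))

  rotation-∷ : ∀ c → rotation c ≡ letter m c ∷ rotation-tail c
  rotation-∷ c = cong₂ _∷_ (cong (letter m) (ℕₚ.+-identityʳ c)) (begin
    map g (applyUpTo suc (suc n))   ≡⟨ cong (map g) (Listₚ.map-upTo suc (suc n)) ⟨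
    map g (map suc (upTo (suc n)))  ≡⟨ Listₚ.map-∘ (upTo (suc n)) ⟨
    map (g ∘ suc) (upTo (suc n))    ≡⟨ Listₚ.map-cong (λ j → cong (letter m) (ℕₚ.+-suc c j)) (upTo (suc n)) ⟩
    rotation-tail c                 ∎)
    where
    open ≡-Reasoning
    g = λ j → letter m (c ℕ.+ j)

  rotation-suc : ∀ c → rotation (suc c) ≡ rotation-tail c ++ [ letter m c ]
  rotation-suc c = begin
    map g (upTo m)                     ≡⟨ cong (map g) (Listₚ.upTo-∷ʳ (suc n)) ⟨
    map g (upTo (suc n) ++ [ suc n ])  ≡⟨ Listₚ.map-++ g (upTo (suc n)) [ suc n ] ⟩
    rotation-tail c ++ [ g (suc n) ]   ≡⟨ cong (λ a → rotation-tail c ++ [ a ]) (letter-cong (suc c ℕ.+ suc n) c wraps) ⟩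
    rotation-tail c ++ [ letter m c ]  ∎
    where
    open ≡-Reasoning
    g = λ j → letter m (suc c ℕ.+ j)
    wraps : (suc c ℕ.+ suc n) % m ≡ c % m
    wraps = trans (cong (_% m) (sym (ℕₚ.+-suc c (suc n)))) (ℕ%.[m+n]%n≡m%n c m)

  rotation-∼₁ : ∀ c → rotation c ∼₁ allFin m
  rotation-∼₁ zero    e = cong (count e) (begin
    map (letter m) (upTo m)          ≡⟨ Listₚ.map-upTo (letter m) m ⟩
    applyUpTo (letter m) m           ≡⟨ applyUpTo-tabulate (letter m) m ⟩
    tabulate (letter m ∘ toℕ)        ≡⟨ Listₚ.tabulate-cong letter-toℕ ⟩
    allFin m                         ∎)
    where open ≡-Reasoning
  rotation-∼₁ (suc c) e = begin
    count e (rotation (suc c))                       ≡⟨ cong (count e) (rotation-suc c) ⟩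
    count e (rotation-tail c ++ [ letter m c ])      ≡⟨ count-++ e (rotation-tail c) [ letter m c ] ⟩
    count e (rotation-tail c) ℕ.+ count e [ letter m c ] ≡⟨ ℕₚ.+-comm (count e (rotation-tail c)) _ ⟩
    count e [ letter m c ] ℕ.+ count e (rotation-tail c) ≡⟨ count-++ e [ letter m c ] (rotation-tail c) ⟨
    count e (letter m c ∷ rotation-tail c)           ≡⟨ cong (count e) (rotation-∷ c) ⟨
    count e (rotation c)                             ≡⟨ rotation-∼₁ c e ⟩
    count e (allFin m)                               ∎
    where open ≡-Reasoning

  pairSum-rotation-suc : ∀ (h : Letter m → Letter m → ℤ) c →
    pairSum h (rotation (suc c)) ≡ pairSum h (rotation c) + sumMap (λ b → h b (letter m c) - h (letter m c) b) (allFin m)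
  pairSum-rotation-suc h c = begin
    pairSum h (rotation (suc c))
      ≡⟨ ring (pairSum h (rotation (suc c))) (pairSum h (ℓ ∷ t)) ⟩
    pairSum h (ℓ ∷ t) + (pairSum h (rotation (suc c)) - pairSum h (ℓ ∷ t))
      ≡⟨ cong (λ w → pairSum h (ℓ ∷ t) + (pairSum h w - pairSum h (ℓ ∷ t))) (rotation-suc c) ⟩
    pairSum h (ℓ ∷ t) + (pairSum h (t ++ [ ℓ ]) - pairSum h (ℓ ∷ t))
      ≡⟨ cong (_+_ (pairSum h (ℓ ∷ t))) (pairSum-rotate h ℓ t) ⟩
    pairSum h (ℓ ∷ t) + sumMap D t
      ≡⟨ cong (_+_ (pairSum h (ℓ ∷ t)))
              (trans (sym (ℤₚ.+-identityˡ _)) (cong (_+ sumMap D t) (sym (ℤₚ.+-inverseʳ (h ℓ ℓ))))) ⟩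
    pairSum h (ℓ ∷ t) + sumMap D (ℓ ∷ t)
      ≡⟨ cong (λ w → pairSum h w + sumMap D w) (rotation-∷ c) ⟨
    pairSum h (rotation c) + sumMap D (rotation c)
      ≡⟨ cong (_+_ (pairSum h (rotation c))) (sumMap-∼₁ D {rotation c} {allFin m} (rotation-∼₁ c)) ⟩
    pairSum h (rotation c) + sumMap D (allFin m) ∎
    where
    open ≡-Reasoning
    ℓ = letter m c
    t = rotation-tail c
    D = λ b → h b ℓ - h ℓ b
    ring : ∀ x y → x ≡ y + (x - y)
    ring = solve-∀

  pairSum-σ-letter : ∀ (h : Letter m → Letter m → ℤ) κ →
    (∀ a → sumMap (λ b → h b a - h a b) (allFin m) ≡ κ * (𝟙 -1ₘ a - 𝟙 0ₘ a)) →
    ∀ a a′ → pairSum h (σ-letter m a) - pairSum h (σ-letter m a′) ≡ κ * (𝟙 0ₘ a - 𝟙 0ₘ a′)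
  pairSum-σ-letter h κ flux a a′ = begin
    g (toℕ a) - g (toℕ a′)
      ≡⟨ cong₂ _-_ (walk (toℕ a) (Finₚ.toℕ<n a)) (walk (toℕ a′) (Finₚ.toℕ<n a′)) ⟩
    (g 0 + κ * (𝟙 0ₘ (letter m (toℕ a)) - + 1)) - (g 0 + κ * (𝟙 0ₘ (letter m (toℕ a′)) - + 1))
      ≡⟨ cong₂ (λ b b′ → (g 0 + κ * (𝟙 0ₘ b - + 1)) - (g 0 + κ * (𝟙 0ₘ b′ - + 1))) (letter-toℕ a) (letter-toℕ a′) ⟩
    (g 0 + κ * (𝟙 0ₘ a - + 1)) - (g 0 + κ * (𝟙 0ₘ a′ - + 1))
      ≡⟨ ring (g 0) κ (𝟙 0ₘ a) (𝟙 0ₘ a′) ⟩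
    κ * (𝟙 0ₘ a - 𝟙 0ₘ a′) ∎
    where
    open ≡-Reasoning
    g : ℕ → ℤ
    g c = pairSum h (rotation c)
    ring : ∀ g₀ κ i i′ → (g₀ + κ * (i - + 1)) - (g₀ + κ * (i′ - + 1)) ≡ κ * (i - i′)
    ring = solve-∀
    -- Going from rotation 0 to rotation (m − 1) only moves the letters 0, 1, …, m − 2 to the
    -- end, and of these only 0 is 0ₘ or -1ₘ.
    walk : ∀ c → c < m → g c ≡ g 0 + κ * (𝟙 0ₘ (letter m c) - + 1)
    walk zero    _       = ring₀ (g 0) κ (𝟙 0ₘ 0ₘ) (𝟙-≡ {e = 0ₘ} refl)
      where ring₀ : ∀ g₀ κ i → i ≡ + 1 → g₀ ≡ g₀ + κ * (i - + 1)
            ring₀ g₀ κ i refl = sym (trans (cong (_+_ g₀) (ℤₚ.*-zeroʳ κ)) (ℤₚ.+-identityʳ g₀))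
    walk (suc c) 1+c<m = begin
      g (suc c)
        ≡⟨ trans (pairSum-rotation-suc h c) (cong (_+_ (g c)) (flux ℓ)) ⟩
      g c + κ * (𝟙 -1ₘ ℓ - 𝟙 0ₘ ℓ)
        ≡⟨ cong (λ y → y + κ * (𝟙 -1ₘ ℓ - 𝟙 0ₘ ℓ)) (walk c (ℕₚ.<-trans (ℕₚ.n<1+n c) 1+c<m)) ⟩
      g 0 + κ * (𝟙 0ₘ ℓ - + 1) + κ * (𝟙 -1ₘ ℓ - 𝟙 0ₘ ℓ)
        ≡⟨ ring₁ (g 0) κ (𝟙 0ₘ ℓ) (𝟙 -1ₘ ℓ) ⟩
      g 0 + κ * (𝟙 -1ₘ ℓ - + 1)
        ≡⟨ cong (λ i → g 0 + κ * (i - + 1))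
                (trans (𝟙-≢ (-1ₘ≢letter (ℕₚ.≤-pred 1+c<m))) (sym (𝟙-≢ (0ₘ≢letter 1+c<m)))) ⟩
      g 0 + κ * (𝟙 0ₘ (letter m (suc c)) - + 1) ∎
      where
      ℓ = letter m c
      ring₁ : ∀ g₀ κ i j → g₀ + κ * (i - + 1) + κ * (j - i) ≡ g₀ + κ * (j - + 1)
      ring₁ = solve-∀

  σ-letter-∼₁ : ∀ a → σ-letter m a ∼₁ allFin m
  σ-letter-∼₁ a = rotation-∼₁ (toℕ a)

  length-σ : ∀ w → length (σ m w) ≡ m ℕ.* length w
  length-σ []      = sym (ℕₚ.*-zeroʳ m)
  length-σ (c ∷ w) = begin
    length (σ-letter m c ++ σ m w)          ≡⟨ Listₚ.length-++ (σ-letter m c) ⟩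
    length (σ-letter m c) ℕ.+ length (σ m w) ≡⟨ cong₂ ℕ._+_ (trans (Listₚ.length-map _ (upTo m)) (Listₚ.length-upTo m))
                                                            (length-σ w) ⟩
    m ℕ.+ m ℕ.* length w                    ≡⟨ ℕₚ.*-suc m (length w) ⟨
    m ℕ.* suc (length w)                    ∎
    where open ≡-Reasoning

  count-σ : ∀ e w → count e (σ m w) ≡ length w
  count-σ e []      = refl
  count-σ e (c ∷ w) = trans (count-++ e (σ-letter m c) (σ m w))
                            (cong₂ ℕ._+_ (trans (σ-letter-∼₁ c e) (count-allFin e)) (count-σ e w))

  σ-∼₁ : ∀ u u′ → length u ≡ length u′ → σ m u ∼₁ σ m u′
  σ-∼₁ u u′ |u|≡|u′| e = trans (count-σ e u) (trans |u|≡|u′| (sym (count-σ e u′)))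

  σ^-σ : ∀ K w → σ^ m K (σ m w) ≡ σ m (σ^ m K w)
  σ^-σ zero    w = refl
  σ^-σ (suc K) w = cong (σ m) (σ^-σ K w)

  σ^-++ : ∀ K u v → σ^ m K (u ++ v) ≡ σ^ m K u ++ σ^ m K v
  σ^-++ zero    u v = refl
  σ^-++ (suc K) u v = trans (cong (σ m) (σ^-++ K u v)) (Listₚ.concatMap-++ (σ-letter m) (σ^ m K u) (σ^ m K v))

  block : ℕ → Letter m → Word m
  block K a = σ^ m K [ a ]

  σ^-concatMap : ∀ K w → σ^ m K w ≡ concatMap (block K) w
  σ^-concatMap zero    []      = refl
  σ^-concatMap (suc K) []      = cong (σ m) (σ^-concatMap K [])
  σ^-concatMap K       (c ∷ w) = trans (σ^-++ K [ c ] w) (cong (block K c ++_) (σ^-concatMap K w))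

  length-σ^ : ∀ K w → + length (σ^ m K w) ≡ (+ m) ^ K * + length w
  length-σ^ zero    w = sym (ℤₚ.*-identityˡ (+ length w))
  length-σ^ (suc K) w = begin
    + length (σ m (σ^ m K w))             ≡⟨ cong +_ (length-σ (σ^ m K w)) ⟩
    + (m ℕ.* length (σ^ m K w))           ≡⟨ ℤₚ.pos-* m (length (σ^ m K w)) ⟩
    + m * + length (σ^ m K w)             ≡⟨ cong (_*_ (+ m)) (length-σ^ K w) ⟩
    + m * ((+ m) ^ K * + length w)        ≡⟨ ℤₚ.*-assoc (+ m) ((+ m) ^ K) (+ length w) ⟨
    (+ m) ^ suc K * + length w            ∎
    where open ≡-Reasoning

  binom-block-letter : ∀ K b y → length y ≡ 1 → + binom (block (suc K) b) y ≡ (+ m) ^ K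
  binom-block-letter K b (e ∷ []) _ = begin
    + binom (σ m (block K b)) [ e ]   ≡⟨ cong +_ (trans (binom-letter e (σ m (block K b))) (count-σ e (block K b))) ⟩
    + length (block K b)              ≡⟨ length-σ^ K [ b ] ⟩
    (+ m) ^ K * + 1                   ≡⟨ ℤₚ.*-identityʳ ((+ m) ^ K) ⟩
    (+ m) ^ K                         ∎
    where open ≡-Reasoning

  σ-sucₘ : ∀ w → σ m (map sucₘ w) ≡ map sucₘ (σ m w)
  σ-sucₘ []      = refl
  σ-sucₘ (c ∷ w) = trans (cong₂ _++_ σ-letter-sucₘ (σ-sucₘ w)) (sym (Listₚ.map-++ sucₘ (σ-letter m c) (σ m w)))
    where
    σ-letter-sucₘ : σ-letter m (sucₘ c) ≡ map sucₘ (σ-letter m c)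
    σ-letter-sucₘ = trans (Listₚ.map-cong shift (upTo m)) (Listₚ.map-∘ (upTo m))
      where
      shift : ∀ j → letter m (toℕ (sucₘ c) ℕ.+ j) ≡ sucₘ (letter m (toℕ c ℕ.+ j))
      shift j = letter-cong (toℕ (sucₘ c) ℕ.+ j) (suc (toℕ (letter m (toℕ c ℕ.+ j)))) (begin
        (toℕ (sucₘ c) ℕ.+ j) % m                       ≡⟨ cong (λ k → (k ℕ.+ j) % m) (toℕ-sucₘ c) ⟩
        (suc (toℕ c) % m ℕ.+ j) % m                    ≡⟨ %-absorbˡ (suc (toℕ c)) j ⟩
        (suc (toℕ c) ℕ.+ j) % m                        ≡⟨ %-absorbʳ 1 (toℕ c ℕ.+ j) ⟨
        (1 ℕ.+ (toℕ c ℕ.+ j) % m) % m                  ≡⟨ cong (λ k → suc k % m) (toℕ-letter (toℕ c ℕ.+ j)) ⟨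
        suc (toℕ (letter m (toℕ c ℕ.+ j))) % m         ∎)
        where open ≡-Reasoning

  σ^-sucₘ : ∀ K w → σ^ m K (map sucₘ w) ≡ map sucₘ (σ^ m K w)
  σ^-sucₘ zero    w = refl
  σ^-sucₘ (suc K) w = trans (cong (σ m) (σ^-sucₘ K w)) (σ-sucₘ (σ^ m K w))

  Q : Word m → ℤ
  Q = pairSum (λ a b → 𝟙 0ₘ a + 𝟙 -1ₘ b)

  Q-++ : ∀ x y → Q (x ++ y) ≡ Q x + Q y + + count 0ₘ x * + length y + + length x * + count -1ₘ y
  Q-++ x y = begin
    Q (x ++ y)
      ≡⟨ pairSum-++ (λ a b → 𝟙 0ₘ a + 𝟙 -1ₘ b) x y ⟩
    Q x + Q y + sumMap (λ a → sumMap (λ b → 𝟙 0ₘ a + 𝟙 -1ₘ b) y) x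
      ≡⟨ cong (_+_ (Q x + Q y)) (sumMap-sumMap-+ (𝟙 0ₘ) (𝟙 -1ₘ) x y) ⟩
    Q x + Q y + (sumMap (𝟙 0ₘ) x * + length y + + length x * sumMap (𝟙 -1ₘ) y)
      ≡⟨ cong₂ (λ c c′ → Q x + Q y + (c * + length y + + length x * c′)) (sumMap-𝟙 0ₘ x) (sumMap-𝟙 -1ₘ y) ⟩
    Q x + Q y + (+ count 0ₘ x * + length y + + length x * + count -1ₘ y)
      ≡⟨ ℤₚ.+-assoc (Q x + Q y) _ _ ⟨
    Q x + Q y + + count 0ₘ x * + length y + + length x * + count -1ₘ y ∎
    where open ≡-Reasoning

  Q-σ-letter : ∀ a a′ → Q (σ-letter m a) - Q (σ-letter m a′) ≡ + m * (𝟙 0ₘ a - 𝟙 0ₘ a′)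
  Q-σ-letter = pairSum-σ-letter (λ a b → 𝟙 0ₘ a + 𝟙 -1ₘ b) (+ m) flux
    where
    flux : ∀ c → sumMap (λ b → (𝟙 0ₘ b + 𝟙 -1ₘ c) - (𝟙 0ₘ c + 𝟙 -1ₘ b)) (allFin m) ≡ + m * (𝟙 -1ₘ c - 𝟙 0ₘ c)
    flux c = begin
      sumMap (λ b → (𝟙 0ₘ b + 𝟙 -1ₘ c) - (𝟙 0ₘ c + 𝟙 -1ₘ b)) (allFin m)
        ≡⟨ sumMap-- (λ b → 𝟙 0ₘ b + 𝟙 -1ₘ c) (λ b → 𝟙 0ₘ c + 𝟙 -1ₘ b) (allFin m) ⟩
      sumMap (λ b → 𝟙 0ₘ b + 𝟙 -1ₘ c) (allFin m) - sumMap (λ b → 𝟙 0ₘ c + 𝟙 -1ₘ b) (allFin m)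
        ≡⟨ cong₂ _-_ (sumMap-+ (𝟙 0ₘ) (λ _ → 𝟙 -1ₘ c) (allFin m)) (sumMap-+ (λ _ → 𝟙 0ₘ c) (𝟙 -1ₘ) (allFin m)) ⟩
      (sumMap (𝟙 0ₘ) (allFin m) + sumMap (λ _ → 𝟙 -1ₘ c) (allFin m))
        - (sumMap (λ _ → 𝟙 0ₘ c) (allFin m) + sumMap (𝟙 -1ₘ) (allFin m))
        ≡⟨ cong₂ _-_ (cong₂ _+_ (sumMap-𝟙-allFin 0ₘ) (sumMap-allFin-const (𝟙 -1ₘ c)))
                     (cong₂ _+_ (sumMap-allFin-const (𝟙 0ₘ c)) (sumMap-𝟙-allFin -1ₘ)) ⟩
      (+ 1 + 𝟙 -1ₘ c * + m) - (𝟙 0ₘ c * + m + + 1)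
        ≡⟨ ring (𝟙 -1ₘ c) (𝟙 0ₘ c) (+ m) ⟩
      + m * (𝟙 -1ₘ c - 𝟙 0ₘ c) ∎
      where
      open ≡-Reasoning
      sumMap-allFin-const : ∀ k → sumMap (λ _ → k) (allFin m) ≡ k * + m
      sumMap-allFin-const k = trans (sumMap-const k (allFin m)) (cong (λ l → k * + l) (Listₚ.length-tabulate id))
      ring : ∀ i j M → (+ 1 + i * M) - (j * M + + 1) ≡ M * (i - j)
      ring = solve-∀

  binom-σ-letter : ∀ a a′ → Δbinom (σ-letter m a) (σ-letter m a′) (0ₘ ∷ -1ₘ ∷ []) ≡ 𝟙 0ₘ a - 𝟙 0ₘ a′
  binom-σ-letter a a′ = begin
    Δbinom (σ-letter m a) (σ-letter m a′) (0ₘ ∷ -1ₘ ∷ [])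
      ≡⟨ cong₂ _-_ (binom-pair 0ₘ -1ₘ (σ-letter m a)) (binom-pair 0ₘ -1ₘ (σ-letter m a′)) ⟩
    pairSum h (σ-letter m a) - pairSum h (σ-letter m a′)
      ≡⟨ pairSum-σ-letter h (+ 1) flux a a′ ⟩
    + 1 * (𝟙 0ₘ a - 𝟙 0ₘ a′)
      ≡⟨ ℤₚ.*-identityˡ _ ⟩
    𝟙 0ₘ a - 𝟙 0ₘ a′ ∎
    where
    open ≡-Reasoning
    h : Letter m → Letter m → ℤ
    h a b = 𝟙 0ₘ a * 𝟙 -1ₘ b
    flux : ∀ c → sumMap (λ b → h b c - h c b) (allFin m) ≡ + 1 * (𝟙 -1ₘ c - 𝟙 0ₘ c)
    flux c = begin
      sumMap (λ b → h b c - h c b) (allFin m)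
        ≡⟨ sumMap-- (λ b → h b c) (h c) (allFin m) ⟩
      sumMap (λ b → 𝟙 0ₘ b * 𝟙 -1ₘ c) (allFin m) - sumMap (λ b → 𝟙 0ₘ c * 𝟙 -1ₘ b) (allFin m)
        ≡⟨ cong₂ _-_ (trans (sumMap-cong (λ b → ℤₚ.*-comm (𝟙 0ₘ b) (𝟙 -1ₘ c)) (allFin m))
                            (sumMap-*ˡ (𝟙 -1ₘ c) (𝟙 0ₘ) (allFin m)))
                     (sumMap-*ˡ (𝟙 0ₘ c) (𝟙 -1ₘ) (allFin m)) ⟩
      𝟙 -1ₘ c * sumMap (𝟙 0ₘ) (allFin m) - 𝟙 0ₘ c * sumMap (𝟙 -1ₘ) (allFin m)
        ≡⟨ cong₂ (λ p q → 𝟙 -1ₘ c * p - 𝟙 0ₘ c * q) (sumMap-𝟙-allFin 0ₘ) (sumMap-𝟙-allFin -1ₘ) ⟩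
      𝟙 -1ₘ c * + 1 - 𝟙 0ₘ c * + 1
        ≡⟨ ring (𝟙 -1ₘ c) (𝟙 0ₘ c) ⟩
      + 1 * (𝟙 -1ₘ c - 𝟙 0ₘ c) ∎
      where ring : ∀ i j → i * + 1 - j * + 1 ≡ + 1 * (i - j)
            ring = solve-∀

  Q-σ-Δ : ∀ u u′ → length u ≡ length u′ → Q (σ m u) - Q (σ m u′) ≡ + m * (+ count 0ₘ u - + count 0ₘ u′)
  Q-σ-Δ []      []        _   = sym (ℤₚ.*-zeroʳ (+ m))
  Q-σ-Δ (c ∷ v) (c′ ∷ v′) |u| = begin
    Q (σ-letter m c ++ σ m v) - Q (σ-letter m c′ ++ σ m v′)
      ≡⟨ cong₂ _-_ (Q-σ-∷ c v) (trans (Q-σ-∷ c′ v′) (cong (λ l → Q (σ-letter m c′) + Q (σ m v′) + R l) (sym |v|))) ⟩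
    (Q (σ-letter m c) + Q (σ m v) + R (length v)) - (Q (σ-letter m c′) + Q (σ m v′) + R (length v))
      ≡⟨ ring (Q (σ-letter m c)) (Q (σ m v)) (Q (σ-letter m c′)) (Q (σ m v′)) (R (length v)) ⟩
    (Q (σ-letter m c) - Q (σ-letter m c′)) + (Q (σ m v) - Q (σ m v′))
      ≡⟨ cong₂ _+_ (Q-σ-letter c c′) (Q-σ-Δ v v′ |v|) ⟩
    + m * (𝟙 0ₘ c - 𝟙 0ₘ c′) + + m * (+ count 0ₘ v - + count 0ₘ v′)
      ≡⟨ distrib (+ m) (𝟙 0ₘ c) (𝟙 0ₘ c′) (+ count 0ₘ v) (+ count 0ₘ v′) ⟩
    + m * ((𝟙 0ₘ c + + count 0ₘ v) - (𝟙 0ₘ c′ + + count 0ₘ v′))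
      ≡⟨ cong₂ (λ p q → + m * (p - q)) (count-∷ 0ₘ c v) (count-∷ 0ₘ c′ v′) ⟨
    + m * (+ count 0ₘ (c ∷ v) - + count 0ₘ (c′ ∷ v′)) ∎
    where
    open ≡-Reasoning
    |v| = ℕₚ.suc-injective |u|
    R : ℕ → ℤ
    R l = + 1 * + (m ℕ.* l) + + m * + l
    Q-σ-∷ : ∀ c v → Q (σ-letter m c ++ σ m v) ≡ Q (σ-letter m c) + Q (σ m v) + R (length v)
    Q-σ-∷ c v = trans (Q-++ (σ-letter m c) (σ m v)) (trans (ℤₚ.+-assoc (Q (σ-letter m c) + Q (σ m v)) _ _)
      (cong (_+_ (Q (σ-letter m c) + Q (σ m v)))
        (cong₂ _+_ (cong₂ (λ k l → + k * + l) (trans (σ-letter-∼₁ c 0ₘ) (count-allFin 0ₘ)) (length-σ v))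
                   (cong₂ (λ k l → + k * + l) (trans (Listₚ.length-map _ (upTo m)) (Listₚ.length-upTo m)) (count-σ -1ₘ v)))))
    ring : ∀ a b a′ b′ r → (a + b + r) - (a′ + b′ + r) ≡ (a - a′) + (b - b′)
    ring = solve-∀
    distrib : ∀ M x x′ y y′ → M * (x - x′) + M * (y - y′) ≡ M * ((x + y) - (x′ + y′))
    distrib = solve-∀

  P : ℕ → Word m
  P = pattern-word m

  length-P : ∀ k → length (P k) ≡ suc k
  length-P k = trans (Listₚ.length-map _ (upTo (suc k))) (Listₚ.length-upTo (suc k))

  take-P : ∀ k → take (suc k) (P (suc k)) ≡ P k
  take-P k = trans (Listₚ.take-map (suc k) (upTo (suc (suc k)))) (cong (map _) (take-applyUpTo id (suc k)))

  sucₘ-tail-P : ∀ k → map sucₘ (drop 1 (P (suc k))) ≡ P k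
  sucₘ-tail-P k = begin
    map sucₘ (map g (applyUpTo suc (suc k)))   ≡⟨ Listₚ.map-∘ (applyUpTo suc (suc k)) ⟨
    map (sucₘ ∘ g) (applyUpTo suc (suc k))     ≡⟨ cong (map (sucₘ ∘ g)) (Listₚ.map-upTo suc (suc k)) ⟨
    map (sucₘ ∘ g) (map suc (upTo (suc k)))    ≡⟨ Listₚ.map-∘ (upTo (suc k)) ⟨
    map (sucₘ ∘ g ∘ suc) (upTo (suc k))        ≡⟨ Listₚ.map-cong sucₘ-neg (upTo (suc k)) ⟩
    P k                                        ∎
    where
    open ≡-Reasoning
    g = λ i → neg m (letter m i)

  P-0 : P 0 ≡ [ 0ₘ ]
  P-0 = cong [_] neg-0ₘ

  P-1 : P 1 ≡ 0ₘ ∷ -1ₘ ∷ []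
  P-1 = cong (_∷ [ -1ₘ ]) neg-0ₘ

  block-∼ : ∀ K a a′ → block K a ∼[ K ] block K a′
  block-∼ zero    a a′ []      _      = refl
  block-∼ (suc K) a a′ y       |y|≤1+K = begin
    binom (block (suc K) a) y                   ≡⟨ cong (λ w → binom w y) (block-suc a) ⟩
    binom (concatMap (block K) (σ m [ a ])) y   ≡⟨ concatMap-∼₁ (block K) (block-∼ K) (σ-∼₁ [ a ] [ a′ ] refl) y |y|≤1+K ⟩
    binom (concatMap (block K) (σ m [ a′ ])) y  ≡⟨ cong (λ w → binom w y) (block-suc a′) ⟨
    binom (block (suc K) a′) y                  ∎
    where
    open ≡-Reasoning
    block-suc : ∀ a → block (suc K) a ≡ concatMap (block K) (σ m [ a ])
    block-suc a = trans (sym (σ^-σ K [ a ])) (σ^-concatMap K (σ m [ a ]))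

  M : ℕ → ℤ
  M K = (+ m) ^ (K C 2)

  M-suc : ∀ K → M (suc K) ≡ (+ m) ^ K * M K
  M-suc K = trans (cong ((+ m) ^_) (C2-suc K)) (ℤₚ.^-distribˡ-+-* (+ m) K (K C 2))

  PatternBinom : ℕ → Set
  PatternBinom K = ∀ a a′ → Δbinom (block K a) (block K a′) (P K) ≡ M K * (𝟙 0ₘ a - 𝟙 0ₘ a′)

  pattern-offset : ℕ → ℤ
  pattern-offset K = + binom (block K 0ₘ) (P K) - M K

  pattern-affine : ∀ {K} → PatternBinom K → ∀ a → + binom (block K a) (P K) ≡ pattern-offset K + M K * 𝟙 0ₘ a
  pattern-affine {K} hK a = solve (+ binom (block K a) (P K)) (+ binom (block K 0ₘ) (P K)) (M K) (𝟙 0ₘ a) (𝟙 0ₘ 0ₘ)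
                                  (hK a 0ₘ) (𝟙-≡ {e = 0ₘ} refl)
    where
    solve : ∀ t t₀ μ i i₀ → t - t₀ ≡ μ * (i - i₀) → i₀ ≡ + 1 → t ≡ (t₀ - μ) + μ * i
    solve t t₀ μ i i₀ eq refl = trans (ring₁ t t₀) (trans (cong (_+ t₀) eq) (ring₂ t₀ μ i))
      where
      ring₁ : ∀ t t₀ → t ≡ (t - t₀) + t₀
      ring₁ = solve-∀
      ring₂ : ∀ t₀ μ i → μ * (i - + 1) + t₀ ≡ (t₀ - μ) + μ * i
      ring₂ = solve-∀

  pattern-shift : ∀ K b → + binom (block K b) (drop 1 (P (suc K))) ≡ + binom (block K (sucₘ b)) (P K)
  pattern-shift K b = cong +_ (begin
    binom (block K b) (drop 1 (P (suc K)))
      ≡⟨ binom-map-injective sucₘ-injective (block K b) (drop 1 (P (suc K))) ⟨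
    binom (map sucₘ (block K b)) (map sucₘ (drop 1 (P (suc K))))
      ≡⟨ cong₂ binom (sym (σ^-sucₘ K [ b ])) (sucₘ-tail-P K) ⟩
    binom (block K (sucₘ b)) (P K) ∎)
    where open ≡-Reasoning

  module PatternBlocks (K : ℕ) = Blocks (block K) K (block-∼ K)

  pattern-kernel : ∀ K → PatternBinom (suc K) → ∀ a b →
    PatternBlocks.kernel (suc K) (P (2 ℕ.+ K)) a b
      ≡ + 2 * ((+ m) ^ K * pattern-offset (suc K)) + ((+ m) ^ K * M (suc K)) * (𝟙 0ₘ a + 𝟙 -1ₘ b)
  pattern-kernel K hK a b = begin
    T (take (suc K₁) x) a * T (drop (suc K₁) x) b + T (take 1 x) a * T (drop 1 x) b
      ≡⟨ cong₂ _+_ (cong₂ _*_ prefix (binom-block-letter K b (drop (suc K₁) x) |x₂|))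
                   (cong₂ _*_ (binom-block-letter K a (take 1 x) refl) suffix) ⟩
    (A₀ + M K₁ * 𝟙 0ₘ a) * (+ m) ^ K + (+ m) ^ K * (A₀ + M K₁ * 𝟙 -1ₘ b)
      ≡⟨ ring A₀ (M K₁) ((+ m) ^ K) (𝟙 0ₘ a) (𝟙 -1ₘ b) ⟩
    + 2 * ((+ m) ^ K * A₀) + ((+ m) ^ K * M K₁) * (𝟙 0ₘ a + 𝟙 -1ₘ b) ∎
    where
    open ≡-Reasoning
    K₁ = suc K
    x = P (suc K₁)
    open PatternBlocks K₁ using (T)
    A₀ = pattern-offset K₁
    |x₂| : length (drop (suc K₁) x) ≡ 1
    |x₂| = trans (Listₚ.length-drop (suc K₁) x) (trans (cong (_∸ suc K₁) (length-P (suc K₁))) (ℕₚ.m+n∸n≡m 1 K₁))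
    prefix : T (take (suc K₁) x) a ≡ A₀ + M K₁ * 𝟙 0ₘ a
    prefix = trans (cong (λ y → + binom (block K₁ a) y) (take-P K₁)) (pattern-affine {K₁} hK a)
    suffix : T (drop 1 x) b ≡ A₀ + M K₁ * 𝟙 -1ₘ b
    suffix = trans (pattern-shift K₁ b) (trans (pattern-affine {K₁} hK (sucₘ b)) (cong (λ i → A₀ + M K₁ * i) (𝟙-sucₘ b)))
    ring : ∀ A M μ i j → (A + M * i) * μ + μ * (A + M * j) ≡ + 2 * (μ * A) + (μ * M) * (i + j)
    ring = solve-∀

  σ^-pattern-Δ : ∀ K → PatternBinom (suc K) → ∀ w w′ → w ∼₁ w′ →
    Δbinom (σ^ m (suc K) w) (σ^ m (suc K) w′) (P (2 ℕ.+ K)) ≡ ((+ m) ^ K * M (suc K)) * (Q w - Q w′)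
  σ^-pattern-Δ K hK w w′ w∼w′ = begin
    Δbinom (σ^ m K₁ w) (σ^ m K₁ w′) x
      ≡⟨ cong₂ (λ v v′ → Δbinom v v′ x) (σ^-concatMap K₁ w) (σ^-concatMap K₁ w′) ⟩
    Δbinom (concatMap (block K₁) w) (concatMap (block K₁) w′) x
      ≡⟨ concatMap-Δ₂ (s≤s z≤n) w w′ |w|≡|w′| x (length-P (suc K₁)) ⟩
    (sumMap (T x) w + pairSum (kernel x) w) - (S′ + pairSum (kernel x) w′)
      ≡⟨ cong₂ (λ s p → (s + p) - (S′ + pairSum (kernel x) w′)) (sumMap-∼₁ (T x) {w} {w′} w∼w′) (pairSum-kernel w) ⟩
    (S′ + (κ * + (length w C 2) + λ′ * Q w)) - (S′ + pairSum (kernel x) w′)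
      ≡⟨ cong₂ (λ l p → (S′ + (κ * + (l C 2) + λ′ * Q w)) - (S′ + p)) |w|≡|w′| (pairSum-kernel w′) ⟩
    (S′ + (κ * + (length w′ C 2) + λ′ * Q w)) - (S′ + (κ * + (length w′ C 2) + λ′ * Q w′))
      ≡⟨ ring S′ κ (+ (length w′ C 2)) λ′ (Q w) (Q w′) ⟩
    λ′ * (Q w - Q w′) ∎
    where
    open ≡-Reasoning
    K₁ = suc K
    x = P (suc K₁)
    open PatternBlocks K₁
    κ = + 2 * ((+ m) ^ K * pattern-offset K₁)
    λ′ = (+ m) ^ K * M K₁
    S′ = sumMap (T x) w′
    |w|≡|w′| = length-∼₁ {u = w} {w′} w∼w′
    pairSum-kernel : ∀ v → pairSum (kernel x) v ≡ κ * + (length v C 2) + λ′ * Q v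
    pairSum-kernel v = trans (pairSum-cong (pattern-kernel K hK) v) (pairSum-affine κ λ′ (λ a b → 𝟙 0ₘ a + 𝟙 -1ₘ b) v)
    ring : ∀ s κ c λ′ q q′ → (s + (κ * c + λ′ * q)) - (s + (κ * c + λ′ * q′)) ≡ λ′ * (q - q′)
    ring = solve-∀

  pattern-binom : ∀ K → PatternBinom K
  pattern-binom zero          a a′ = begin
    Δbinom [ a ] [ a′ ] (P 0)     ≡⟨ cong (Δbinom [ a ] [ a′ ]) P-0 ⟩
    Δbinom [ a ] [ a′ ] [ 0ₘ ]    ≡⟨ cong₂ (λ p q → + p - + q) (binom-letter 0ₘ [ a ]) (binom-letter 0ₘ [ a′ ]) ⟩
    𝟙 0ₘ a - 𝟙 0ₘ a′              ≡⟨ ℤₚ.*-identityˡ _ ⟨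
    M 0 * (𝟙 0ₘ a - 𝟙 0ₘ a′)      ∎
    where open ≡-Reasoning
  pattern-binom (suc zero)    a a′ = begin
    Δbinom (σ-letter m a ++ []) (σ-letter m a′ ++ []) (P 1)
      ≡⟨ cong₂ (λ v v′ → Δbinom v v′ (P 1)) (Listₚ.++-identityʳ (σ-letter m a)) (Listₚ.++-identityʳ (σ-letter m a′)) ⟩
    Δbinom (σ-letter m a) (σ-letter m a′) (P 1)
      ≡⟨ cong (Δbinom (σ-letter m a) (σ-letter m a′)) P-1 ⟩
    Δbinom (σ-letter m a) (σ-letter m a′) (0ₘ ∷ -1ₘ ∷ [])
      ≡⟨ binom-σ-letter a a′ ⟩
    𝟙 0ₘ a - 𝟙 0ₘ a′
      ≡⟨ ℤₚ.*-identityˡ _ ⟨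
    M 1 * (𝟙 0ₘ a - 𝟙 0ₘ a′) ∎
    where open ≡-Reasoning
  pattern-binom (suc (suc K)) a a′ = begin
    Δbinom (block (2 ℕ.+ K) a) (block (2 ℕ.+ K) a′) (P (2 ℕ.+ K))
      ≡⟨ cong₂ (λ v v′ → Δbinom v v′ (P (2 ℕ.+ K))) (σ^-σ (suc K) [ a ]) (σ^-σ (suc K) [ a′ ]) ⟨
    Δbinom (σ^ m (suc K) (σ m [ a ])) (σ^ m (suc K) (σ m [ a′ ])) (P (2 ℕ.+ K))
      ≡⟨ σ^-pattern-Δ K (pattern-binom (suc K)) (σ m [ a ]) (σ m [ a′ ]) (σ-∼₁ [ a ] [ a′ ] refl) ⟩
    ((+ m) ^ K * M (suc K)) * (Q (σ m [ a ]) - Q (σ m [ a′ ]))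
      ≡⟨ cong (((+ m) ^ K * M (suc K)) *_) (Q-σ-Δ [ a ] [ a′ ] refl) ⟩
    ((+ m) ^ K * M (suc K)) * (+ m * (𝟙 0ₘ a - 𝟙 0ₘ a′))
      ≡⟨ ring ((+ m) ^ K) (M (suc K)) (+ m) (𝟙 0ₘ a - 𝟙 0ₘ a′) ⟩
    ((+ m) ^ suc K * M (suc K)) * (𝟙 0ₘ a - 𝟙 0ₘ a′)
      ≡⟨ cong (_* (𝟙 0ₘ a - 𝟙 0ₘ a′)) (M-suc (suc K)) ⟨
    M (2 ℕ.+ K) * (𝟙 0ₘ a - 𝟙 0ₘ a′) ∎
    where
    open ≡-Reasoning
    ring : ∀ p M q d → (p * M) * (q * d) ≡ (q * p * M) * d
    ring = solve-∀

  Q-insert : ∀ γ u δ → Q (γ ++ σ m u ++ δ) ≡ Q (γ ++ δ) + Q (σ m u) + + length u * (+ length γ + + length δ)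
                                               + (+ m * + length u) * (+ count 0ₘ γ + + count -1ₘ δ)
  Q-insert γ u δ = begin
    Q (γ ++ σ m u ++ δ)
      ≡⟨ Q-++ γ (σ m u ++ δ) ⟩
    Q γ + Q (σ m u ++ δ) + + count 0ₘ γ * + length (σ m u ++ δ) + + length γ * + count -1ₘ (σ m u ++ δ)
      ≡⟨ cong₂ (λ p q → Q γ + Q (σ m u ++ δ) + + count 0ₘ γ * p + + length γ * q)
               (trans (+length-++ (σ m u) δ) (cong (_+ + length δ) +length-σ))
               (trans (+count-++ -1ₘ (σ m u) δ) (cong (_+ + count -1ₘ δ) (cong +_ (count-σ -1ₘ u)))) ⟩
    Q γ + Q (σ m u ++ δ) + + count 0ₘ γ * (+ m * U + + length δ) + + length γ * (U + + count -1ₘ δ)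
      ≡⟨ cong (λ q → Q γ + q + + count 0ₘ γ * (+ m * U + + length δ) + + length γ * (U + + count -1ₘ δ))
              (trans (Q-++ (σ m u) δ) (cong₂ (λ p q → Q (σ m u) + Q δ + p * + length δ + q * + count -1ₘ δ)
                                             (cong +_ (count-σ 0ₘ u)) +length-σ)) ⟩
    Q γ + (Q (σ m u) + Q δ + U * + length δ + (+ m * U) * + count -1ₘ δ)
      + + count 0ₘ γ * (+ m * U + + length δ) + + length γ * (U + + count -1ₘ δ)
      ≡⟨ ring (Q γ) (Q δ) (Q (σ m u)) U (+ m) (+ length γ) (+ length δ) (+ count 0ₘ γ) (+ count -1ₘ δ) ⟩
    (Q γ + Q δ + + count 0ₘ γ * + length δ + + length γ * + count -1ₘ δ) + Q (σ m u)
      + U * (+ length γ + + length δ) + (+ m * U) * (+ count 0ₘ γ + + count -1ₘ δ)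
      ≡⟨ cong (λ q → q + Q (σ m u) + U * (+ length γ + + length δ) + (+ m * U) * (+ count 0ₘ γ + + count -1ₘ δ))
              (Q-++ γ δ) ⟨
    Q (γ ++ δ) + Q (σ m u) + U * (+ length γ + + length δ) + (+ m * U) * (+ count 0ₘ γ + + count -1ₘ δ) ∎
    where
    open ≡-Reasoning
    U = + length u
    +length-++ : ∀ (x y : Word m) → + length (x ++ y) ≡ + length x + + length y
    +length-++ x y = trans (cong +_ (Listₚ.length-++ x)) (ℤₚ.pos-+ (length x) (length y))
    +count-++ : ∀ e (x y : Word m) → + count e (x ++ y) ≡ + count e x + + count e y
    +count-++ e x y = trans (cong +_ (count-++ e x y)) (ℤₚ.pos-+ (count e x) (count e y))
    +length-σ : + length (σ m u) ≡ + m * U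
    +length-σ = trans (cong +_ (length-σ u)) (ℤₚ.pos-* m (length u))
    ring : ∀ qγ qδ qσ U M lγ lδ zγ oδ →
      qγ + (qσ + qδ + U * lδ + (M * U) * oδ) + zγ * (M * U + lδ) + lγ * (U + oδ)
        ≡ (qγ + qδ + zγ * lδ + lγ * oδ) + qσ + U * (lγ + lδ) + (M * U) * (zγ + oδ)
    ring = solve-∀

  binom₋₁ binom₀ : Word m → Letter m → ℤ
  binom₋₁ v b = + binom v (b ∷ -1ₘ ∷ [])
  binom₀ v b = + binom v (0ₘ ∷ b ∷ [])

  Q-binom : ∀ v → Q v ≡ sumMap (λ b → binom₋₁ v b + binom₀ v b) (allFin m)
  Q-binom v = sym (begin
    sumMap (λ b → binom₋₁ v b + binom₀ v b) (allFin m)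
      ≡⟨ sumMap-cong (λ b → trans (cong₂ _+_ (binom-pair b -1ₘ v) (binom-pair 0ₘ b v))
                                  (sym (pairSum-+ (h₁ b) (h₂ b) v))) (allFin m) ⟩
    sumMap (λ b → pairSum (λ a c → h₁ b a c + h₂ b a c) v) (allFin m)
      ≡⟨ pairSum-sumMap (λ b a c → h₁ b a c + h₂ b a c) (allFin m) v ⟩
    pairSum (λ a c → sumMap (λ b → h₁ b a c + h₂ b a c) (allFin m)) v
      ≡⟨ pairSum-cong collapse v ⟩
    Q v ∎)
    where
    open ≡-Reasoning
    h₁ h₂ : Letter m → Letter m → Letter m → ℤ
    h₁ b a c = 𝟙 b a * 𝟙 -1ₘ c
    h₂ b a c = 𝟙 0ₘ a * 𝟙 b c
    collapse : ∀ a c → sumMap (λ b → h₁ b a c + h₂ b a c) (allFin m) ≡ 𝟙 0ₘ a + 𝟙 -1ₘ c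
    collapse a c = begin
      sumMap (λ b → h₁ b a c + h₂ b a c) (allFin m)
        ≡⟨ sumMap-+ (λ b → h₁ b a c) (λ b → h₂ b a c) (allFin m) ⟩
      sumMap (λ b → 𝟙 b a * 𝟙 -1ₘ c) (allFin m) + sumMap (λ b → 𝟙 0ₘ a * 𝟙 b c) (allFin m)
        ≡⟨ cong₂ _+_ (sumMap-allFin-𝟙 a (λ _ → 𝟙 -1ₘ c))
                     (trans (sumMap-*ˡ (𝟙 0ₘ a) (λ b → 𝟙 b c) (allFin m))
                            (cong (_*_ (𝟙 0ₘ a)) (trans (sumMap-cong (λ b → 𝟙-sym b c) (allFin m)) (sumMap-𝟙-allFin c)))) ⟩
      𝟙 -1ₘ c + 𝟙 0ₘ a * + 1
        ≡⟨ trans (cong (_+_ (𝟙 -1ₘ c)) (ℤₚ.*-identityʳ (𝟙 0ₘ a))) (ℤₚ.+-comm (𝟙 -1ₘ c) (𝟙 0ₘ a)) ⟩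
      𝟙 0ₘ a + 𝟙 -1ₘ c ∎

  Q-Δ-binom : ∀ v v′ → Q v - Q v′ ≡ sumMap (λ b → binom₋₁ v b - binom₋₁ v′ b + binom₀ v b - binom₀ v′ b) (allFin m)
  Q-Δ-binom v v′ = begin
    Q v - Q v′
      ≡⟨ cong₂ _-_ (Q-binom v) (Q-binom v′) ⟩
    sumMap (λ b → binom₋₁ v b + binom₀ v b) (allFin m) - sumMap (λ b → binom₋₁ v′ b + binom₀ v′ b) (allFin m)
      ≡⟨ sumMap-- (λ b → binom₋₁ v b + binom₀ v b) (λ b → binom₋₁ v′ b + binom₀ v′ b) (allFin m) ⟨
    sumMap (λ b → (binom₋₁ v b + binom₀ v b) - (binom₋₁ v′ b + binom₀ v′ b)) (allFin m)
      ≡⟨ sumMap-cong (λ b → ring (binom₋₁ v b) (binom₀ v b) (binom₋₁ v′ b) (binom₀ v′ b)) (allFin m) ⟩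
    sumMap (λ b → binom₋₁ v b - binom₋₁ v′ b + binom₀ v b - binom₀ v′ b) (allFin m) ∎
    where
    open ≡-Reasoning
    ring : ∀ a b a′ b′ → (a + b) - (a′ + b′) ≡ a - a′ + b - b′
    ring = solve-∀

  Q-insert-Δ : ∀ (γ γ′ δ δ′ u u′ : Word m) → (γ ++ δ) ∼₁ (γ′ ++ δ′) → length u ≡ length u′ →
    Q (γ ++ σ m u ++ δ) - Q (γ′ ++ σ m u′ ++ δ′)
      ≡ + m * ((+ count 0ₘ u) - (+ count 0ₘ u′)
               + (+ length u) * ((+ count 0ₘ γ) - (+ count 0ₘ γ′) + (+ count -1ₘ δ) - (+ count -1ₘ δ′)))
        + sumMap (λ b → binom₋₁ (γ ++ δ) b - binom₋₁ (γ′ ++ δ′) b + binom₀ (γ ++ δ) b - binom₀ (γ′ ++ δ′) b) (allFin m)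
  Q-insert-Δ γ γ′ δ δ′ u u′ γδ∼γ′δ′ |u|≡|u′| = begin
    Q (γ ++ σ m u ++ δ) - Q (γ′ ++ σ m u′ ++ δ′)
      ≡⟨ cong₂ _-_ (Q-insert γ u δ) (Q-insert γ′ u′ δ′) ⟩
    (Q (γ ++ δ) + Q (σ m u) + U * L + (+ m * U) * Z) - (Q (γ′ ++ δ′) + Q (σ m u′) + + length u′ * L′ + (+ m * + length u′) * Z′)
      ≡⟨ cong₂ (λ l k → (Q (γ ++ δ) + Q (σ m u) + U * L + (+ m * U) * Z)
                        - (Q (γ′ ++ δ′) + Q (σ m u′) + + k * l + (+ m * + k) * Z′))
               (sym |γδ|≡|γ′δ′|) (sym |u|≡|u′|) ⟩
    (Q (γ ++ δ) + Q (σ m u) + U * L + (+ m * U) * Z) - (Q (γ′ ++ δ′) + Q (σ m u′) + U * L + (+ m * U) * Z′)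
      ≡⟨ ring₁ (Q (γ ++ δ)) (Q (σ m u)) (U * L) (+ m * U) Z (Q (γ′ ++ δ′)) (Q (σ m u′)) Z′ ⟩
    (Q (σ m u) - Q (σ m u′)) + (Q (γ ++ δ) - Q (γ′ ++ δ′)) + (+ m * U) * (Z - Z′)
      ≡⟨ cong₂ (λ p q → p + q + (+ m * U) * (Z - Z′)) (Q-σ-Δ u u′ |u|≡|u′|) (Q-Δ-binom (γ ++ δ) (γ′ ++ δ′)) ⟩
    + m * (+ count 0ₘ u - + count 0ₘ u′) + Y + (+ m * U) * (Z - Z′)
      ≡⟨ ring₂ (+ m) (+ count 0ₘ u) (+ count 0ₘ u′) U
               (+ count 0ₘ γ) (+ count 0ₘ γ′) (+ count -1ₘ δ) (+ count -1ₘ δ′) Y ⟩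
    + m * ((+ count 0ₘ u) - (+ count 0ₘ u′)
           + U * ((+ count 0ₘ γ) - (+ count 0ₘ γ′) + (+ count -1ₘ δ) - (+ count -1ₘ δ′))) + Y ∎
    where
    open ≡-Reasoning
    U = + length u
    L = + length γ + + length δ
    L′ = + length γ′ + + length δ′
    Z = + count 0ₘ γ + + count -1ₘ δ
    Z′ = + count 0ₘ γ′ + + count -1ₘ δ′
    Y = sumMap (λ b → binom₋₁ (γ ++ δ) b - binom₋₁ (γ′ ++ δ′) b + binom₀ (γ ++ δ) b - binom₀ (γ′ ++ δ′) b) (allFin m)
    |γδ|≡|γ′δ′| : L ≡ L′
    |γδ|≡|γ′δ′| = begin
      + length γ + + length δ     ≡⟨ ℤₚ.pos-+ (length γ) (length δ) ⟨
      + (length γ ℕ.+ length δ)   ≡⟨ cong +_ (trans (sym (Listₚ.length-++ γ))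
                                       (trans (length-∼₁ {u = γ ++ δ} {γ′ ++ δ′} γδ∼γ′δ′) (Listₚ.length-++ γ′))) ⟩
      + (length γ′ ℕ.+ length δ′) ≡⟨ ℤₚ.pos-+ (length γ′) (length δ′) ⟩
      + length γ′ + + length δ′   ∎
    ring₁ : ∀ q s ul mU z q′ s′ z′ → (q + s + ul + mU * z) - (q′ + s′ + ul + mU * z′) ≡ (s - s′) + (q - q′) + mU * (z - z′)
    ring₁ = solve-∀
    ring₂ : ∀ M c c′ U zγ zγ′ oδ oδ′ y →
      M * (c - c′) + y + (M * U) * ((zγ + oδ) - (zγ′ + oδ′)) ≡ M * ((c - c′) + U * (zγ - zγ′ + oδ - oδ′)) + y
    ring₂ = solve-∀

lemma4p4 : (m k : ℕ) .{{_ : NonZero m}} → 2 ≤ m → 2 ≤ k →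
  (u u′ γ γ′ δ δ′ : List (Fin m)) →
  (γ ++ δ) ∼₁ (γ′ ++ δ′) → length u ≡ length u′ →
  (+ binom (σ^ m (k ∸ 1) (γ ++ σ m u ++ δ)) (pattern-word m k))
    - (+ binom (σ^ m (k ∸ 1) (γ′ ++ σ m u′ ++ δ′)) (pattern-word m k))
  ≡
  ((+ m) ^ (k C 2)) *
    ((+ count (letter m 0) u) - (+ count (letter m 0) u′)
      + (+ length u) * ((+ count (letter m 0) γ) - (+ count (letter m 0) γ′)
                        + (+ count (neg m (letter m 1)) δ) - (+ count (neg m (letter m 1)) δ′)))
  + ((+ m) ^ ((k C 2) ∸ 1)) *
    foldr _+_ (+ 0)
      (map (λ b → (+ binom (γ ++ δ) (b ∷ neg m (letter m 1) ∷ [])) - (+ binom (γ′ ++ δ′) (b ∷ neg m (letter m 1) ∷ []))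
                  + (+ binom (γ ++ δ) (letter m 0 ∷ b ∷ [])) - (+ binom (γ′ ++ δ′) (letter m 0 ∷ b ∷ [])))
           (allFin m))
lemma4p4 (suc (suc n)) (suc (suc K)) (s≤s (s≤s z≤n)) (s≤s (s≤s z≤n)) u u′ γ γ′ δ δ′ γδ∼γ′δ′ |u|≡|u′| = begin
  Δbinom (σ^ m (suc K) w) (σ^ m (suc K) w′) (P (2 ℕ.+ K))
    ≡⟨ σ^-pattern-Δ K (pattern-binom (suc K)) w w′
         (insert-∼₁ γ γ′ δ δ′ (σ m u) (σ m u′) γδ∼γ′δ′ (σ-∼₁ u u′ |u|≡|u′|)) ⟩
  ((+ m) ^ K * M (suc K)) * (Q w - Q w′)
    ≡⟨ cong (((+ m) ^ K * M (suc K)) *_) (Q-insert-Δ γ γ′ δ δ′ u u′ γδ∼γ′δ′ |u|≡|u′|) ⟩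
  ((+ m) ^ K * M (suc K)) * (+ m * X + Y)
    ≡⟨ ring ((+ m) ^ K) (M (suc K)) (+ m) X Y ⟩
  ((+ m) ^ suc K * M (suc K)) * X + ((+ m) ^ K * M (suc K)) * Y
    ≡⟨ cong₂ (λ p q → p * X + q * Y) (M-suc (suc K)) exponent ⟨
  M (2 ℕ.+ K) * X + (+ m) ^ ((2 ℕ.+ K) C 2 ∸ 1) * Y ∎
  where
  open Alphabet n
  open ≡-Reasoning
  w = γ ++ σ m u ++ δ
  w′ = γ′ ++ σ m u′ ++ δ′
  X = (+ count 0ₘ u) - (+ count 0ₘ u′) + (+ length u) * ((+ count 0ₘ γ) - (+ count 0ₘ γ′) + (+ count -1ₘ δ) - (+ count -1ₘ δ′))
  Y = sumMap (λ b → binom₋₁ (γ ++ δ) b - binom₋₁ (γ′ ++ δ′) b + binom₀ (γ ++ δ) b - binom₀ (γ′ ++ δ′) b) (allFin m)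
  exponent : (+ m) ^ ((2 ℕ.+ K) C 2 ∸ 1) ≡ (+ m) ^ K * M (suc K)
  exponent = trans (cong (λ e → (+ m) ^ (e ∸ 1)) (C2-suc (suc K))) (ℤₚ.^-distribˡ-+-* (+ m) K (suc K C 2))
  ring : ∀ p M q x y → (p * M) * (q * x + y) ≡ (q * p * M) * x + (p * M) * y
  ring = solve-∀
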